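{- Let $g(n):=\omega(n)+1$ and let $g^{ -1}$ denote its Dirichlet inverse. Then: (A) for all $n\ge 1$, $\operatorname{sgn}(g^{ -1}(n))=\lambda(n)$; (B) for all squarefree integers $n\ge 1$, $|g^{ -1}(n)|=\sum_{m=0}^{\omega(n)}\binom{\omega(n)}{m}\, m!$; (C) if $n\ge 2$ and $\Omega(n)=k$ for some $k\ge 1$, then $2\le |g^{ -1}(n)|\le \sum_{j=0}^{k}\binom{k}{j}\, j!$.
   Context: $\omega(n)$ is the number of distinct prime divisors of $n$ ($\omega(1)=0$), $\Omega(n)$ is the number of prime divisors of $n$ counted with multiplicity, and $\lambda(n)=(-1)^{\Omega(n)}$ is the Liouville function. The Dirichlet inverse $g^{ -1}$ satisfies $\sum_{d\mid n} g(d)g^{ -1}(n/d)=1$ if $n=1$ and $0$ otherwise. $\operatorname{sgn}(t)\in\{ -1,0,1\}$ is the sign of a real number $t$. -}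

module Defs where

open import Data.Nat using (ℕ; zero; suc; _+_; _*_; _^_; _≟_; _!)
open import Data.Nat.ListAction using (sum)
open import Data.Nat.Divisibility using (_∣_; _∣?_)
open import Data.Nat.Primality using (Prime; prime?)
open import Data.Nat.Combinatorics using (_C_)
open import Data.Integer as ℤ using (ℤ; +_; -_)
open import Data.List using (List; filter; length; map; upTo; foldr)
import Data.List as List
open import Relation.Nullary using (¬_; yes; no)
open import Relation.Nullary.Decidable using (_×-dec_)

range1 : ℕ → List ℕ
range1 n = map suc (upTo n)

primeDivisors : ℕ → List ℕ
primeDivisors n = filter (λ p → prime? p ×-dec p ∣? n) (range1 n)

ω : ℕ → ℕ
ω n = length (primeDivisors n)

-- multiplicity of p in n (n ≥ 1, p ≥ 2): number of k ∈ [1..n] with p^k ∣ n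
multiplicity : ℕ → ℕ → ℕ
multiplicity p n = length (filter (λ k → (p ^ k) ∣? n) (range1 n))

Ω : ℕ → ℕ
Ω n = sum (map (λ p → multiplicity p n) (primeDivisors n))

liouville : ℕ → ℤ
liouville n = (- (+ 1)) ℤ.^ Ω n

sgn : ℤ → ℤ
sgn (+ zero)    = + 0
sgn (+ (suc _)) = + 1
sgn ℤ.-[1+ _ ]  = - (+ 1)

dirichlet : (ℕ → ℤ) → (ℕ → ℤ) → ℕ → ℤ
dirichlet f h n =
  foldr ℤ._+_ (+ 0)
    (List.concatMap (λ d → map (λ e → term d e) (range1 n)) (range1 n))
  where
    term : ℕ → ℕ → ℤ
    term d e with d * e ≟ n
    ... | yes _ = f d ℤ.* h e
    ... | no  _ = + 0

ε : ℕ → ℤ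
ε 1 = + 1
ε _ = + 0

IsDirichletInverse : (ℕ → ℤ) → (ℕ → ℤ) → Set
IsDirichletInverse g ginv = ∀ n → 1 Data.Nat.≤ n → dirichlet g ginv n ≡ ε n
  where open import Relation.Binary.PropositionalEquality using (_≡_)

g : ℕ → ℤ
g n = + (ω n + 1)

Squarefree : ℕ → Set
Squarefree n = ∀ p → Prime p → ¬ (p * p ∣ n)

arrSum : ℕ → ℕ
arrSum k = sum (map (λ m → (k C m) * (m !)) (upTo (suc k)))

-- With 𝟏 the constant function 1 and ℙ the indicator function of the primes, ω = ℙ ⋆ 𝟏,
-- so g = 𝟏 + ℙ ⋆ 𝟏 and, by associativity of ⋆, g ⋆ G = 𝟏 ⋆ (G + ℙ ⋆ G). Möbius inversion
-- therefore turns g ⋆ G = ε into G + ℙ ⋆ G = μ. Multiplying by the Liouville function, which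
-- changes sign across every prime factor, gives for a = λ G the recurrence
--   a(1) = 1,   a(n) = [n squarefree] + Σ_{p prime, p ∣ n} a(n / p),
-- all of whose terms are nonnegative. Induction over the cofactors n / p then gives a ≥ 1
-- (so sgn G = λ and |G| = a), a(n) ≥ 2 for n ≥ 2, and a(n) ≤ 1 + ω(n) A(Ω(n) − 1) ≤ A(Ω(n)),
-- where A(k) = Σ_m C(k,m) m! satisfies A(k + 1) = 1 + (k + 1) A(k); for squarefree n every
-- one of these inequalities is an equality.

module Submission where

open import Defs
open import Data.Bool using (true; false; if_then_else_)
open import Data.Integer as ℤ using (ℤ; +_; -_; 0ℤ; 1ℤ; +≤+; ∣_∣)
import Data.Integer.Properties as ℤ
open import Data.Integer.Tactic.RingSolver using (solve-∀)
open import Data.List using (List; []; _∷_; map; foldr; upTo; applyUpTo; concatMap; filter; length; _++_)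
import Data.List.Properties as List
open import Data.List.Relation.Unary.All using (_∷_)
open import Data.Nat as ℕ using (ℕ; zero; suc; _≤_; _<_; z≤n; s≤s; _+_; _*_; _^_; _≟_; _!)
import Data.Nat.Properties as ℕ
open import Data.Nat.Combinatorics using (_C_; nCk+nC[k+1]≡[n+1]C[k+1]; nC1≡n)
open import Data.Nat.Coprimality using (Coprime; coprime-divisor) renaming (sym to Coprime-sym)
open import Data.Nat.Divisibility using (_∣_; _∣?_; divides; ∣-refl; ∣-trans; 1∣_; ∣1⇒≡1; m∣m*n; ∣n⇒∣m*n; *-monoʳ-∣; *-cancelˡ-∣; ∣⇒≤; >⇒∤)
open import Data.Nat.Induction using (<-rec)
open import Data.Nat.ListAction using (sum)
open import Data.Nat.Primality using (Prime; prime?; euclidsLemma; prime⇒irreducible; prime⇒nonZero; prime⇒nonTrivial; ¬prime[1])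
open import Data.Nat.Primality.Factorisation using (factorise)
open import Data.Nat.Tactic.RingSolver using () renaming (solve-∀ to ℕ-solve-∀)
open import Data.Product using (∃-syntax; _×_; _,_; proj₁; proj₂)
open import Data.Sum using (_⊎_; inj₁; inj₂)
open import Function using (_∘_)
open import Relation.Nullary using (¬_; Dec; yes; no; does; _because_; contradiction)
open import Relation.Nullary.Reflects using (T-reflects)
open import Relation.Nullary.Decidable using (_×-dec_; ¬?; map′)
open import Relation.Binary.PropositionalEquality

-- Finite sums

infix 4 _∈[1,_]
_∈[1,_] : ℕ → ℕ → Set
i ∈[1, n ] = 1 ≤ i × i ≤ n

-- ∑[ i ≤ n ] ranges over 1 ≤ i ≤ n.
∑ : ℕ → (ℕ → ℤ) → ℤ
∑ zero    f = 0ℤ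
∑ (suc n) f = ∑ n f ℤ.+ f (suc n)

syntax ∑ n (λ i → t) = ∑[ i ≤ n ] t

∈[1,]-suc : ∀ {i n} → i ∈[1, n ] → i ∈[1, suc n ]
∈[1,]-suc (1≤i , i≤n) = 1≤i , ℕ.m≤n⇒m≤1+n i≤n

∈[1,]-top : ∀ {n} → suc n ∈[1, suc n ]
∈[1,]-top = s≤s z≤n , ℕ.≤-refl

∑-cong : ∀ n {f h : ℕ → ℤ} → (∀ i → i ∈[1, n ] → f i ≡ h i) → ∑ n f ≡ ∑ n h
∑-cong zero    eq = refl
∑-cong (suc n) eq = cong₂ ℤ._+_ (∑-cong n (λ i r → eq i (∈[1,]-suc r))) (eq (suc n) ∈[1,]-top)

∑-zero : ∀ n {f : ℕ → ℤ} → (∀ i → i ∈[1, n ] → f i ≡ 0ℤ) → ∑ n f ≡ 0ℤ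
∑-zero zero    eq = refl
∑-zero (suc n) eq = cong₂ ℤ._+_ (∑-zero n (λ i r → eq i (∈[1,]-suc r))) (eq (suc n) ∈[1,]-top)

∑-distrib-+ : ∀ n (f h : ℕ → ℤ) → ∑[ i ≤ n ] (f i ℤ.+ h i) ≡ ∑ n f ℤ.+ ∑ n h
∑-distrib-+ zero    f h = refl
∑-distrib-+ (suc n) f h = begin
  ∑[ i ≤ n ] (f i ℤ.+ h i) ℤ.+ (f (suc n) ℤ.+ h (suc n))
    ≡⟨ cong (ℤ._+ (f (suc n) ℤ.+ h (suc n))) (∑-distrib-+ n f h) ⟩
  (∑ n f ℤ.+ ∑ n h) ℤ.+ (f (suc n) ℤ.+ h (suc n))
    ≡⟨ medial (∑ n f) (∑ n h) (f (suc n)) (h (suc n)) ⟩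
  ∑ (suc n) f ℤ.+ ∑ (suc n) h ∎
  where
  open ≡-Reasoning
  medial : ∀ a b c d → (a ℤ.+ b) ℤ.+ (c ℤ.+ d) ≡ (a ℤ.+ c) ℤ.+ (b ℤ.+ d)
  medial = solve-∀

*-distribˡ-∑ : ∀ c n (f : ℕ → ℤ) → c ℤ.* ∑ n f ≡ ∑[ i ≤ n ] (c ℤ.* f i)
*-distribˡ-∑ c zero    f = ℤ.*-zeroʳ c
*-distribˡ-∑ c (suc n) f =
  trans (ℤ.*-distribˡ-+ c (∑ n f) (f (suc n))) (cong (ℤ._+ (c ℤ.* f (suc n))) (*-distribˡ-∑ c n f))

*-distribʳ-∑ : ∀ c n (f : ℕ → ℤ) → ∑ n f ℤ.* c ≡ ∑[ i ≤ n ] (f i ℤ.* c)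
*-distribʳ-∑ c n f = begin
  ∑ n f ℤ.* c          ≡⟨ ℤ.*-comm (∑ n f) c ⟩
  c ℤ.* ∑ n f          ≡⟨ *-distribˡ-∑ c n f ⟩
  ∑[ i ≤ n ] (c ℤ.* f i) ≡⟨ ∑-cong n (λ i _ → ℤ.*-comm c (f i)) ⟩
  ∑[ i ≤ n ] (f i ℤ.* c) ∎
  where open ≡-Reasoning

∑-comm : ∀ m n (F : ℕ → ℕ → ℤ) → ∑[ i ≤ m ] ∑[ j ≤ n ] F i j ≡ ∑[ j ≤ n ] ∑[ i ≤ m ] F i j
∑-comm zero    n F = sym (∑-zero n (λ _ _ → refl))
∑-comm (suc m) n F = begin
  ∑[ i ≤ m ] ∑[ j ≤ n ] F i j ℤ.+ ∑[ j ≤ n ] F (suc m) j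
    ≡⟨ cong (ℤ._+ ∑[ j ≤ n ] F (suc m) j) (∑-comm m n F) ⟩
  ∑[ j ≤ n ] ∑[ i ≤ m ] F i j ℤ.+ ∑[ j ≤ n ] F (suc m) j
    ≡⟨ ∑-distrib-+ n _ _ ⟨
  ∑[ j ≤ n ] ∑[ i ≤ suc m ] F i j ∎
  where open ≡-Reasoning

∑-mono-≤ : ∀ n {f h : ℕ → ℤ} → (∀ i → i ∈[1, n ] → f i ℤ.≤ h i) → ∑ n f ℤ.≤ ∑ n h
∑-mono-≤ zero    le = ℤ.≤-refl
∑-mono-≤ (suc n) le = ℤ.+-mono-≤ (∑-mono-≤ n (λ i r → le i (∈[1,]-suc r))) (le (suc n) ∈[1,]-top)

∑-shrink : ∀ {m n} {f : ℕ → ℤ} → m ≤ n → (∀ i → m < i → i ≤ n → f i ≡ 0ℤ) → ∑ n f ≡ ∑ m f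
∑-shrink {m} {zero}  z≤n  _    = refl
∑-shrink {m} {suc n} {f} m≤1+n tail with m ℕ.≟ suc n
... | yes refl = refl
... | no  m≢1+n = begin
  ∑ n f ℤ.+ f (suc n) ≡⟨ cong₂ ℤ._+_ (∑-shrink m≤n (λ i m<i i≤n → tail i m<i (ℕ.m≤n⇒m≤1+n i≤n)))
                                     (tail (suc n) (s≤s m≤n) ℕ.≤-refl) ⟩
  ∑ m f ℤ.+ 0ℤ        ≡⟨ ℤ.+-identityʳ _ ⟩
  ∑ m f               ∎
  where
  open ≡-Reasoning
  m≤n : m ≤ n
  m≤n = ℕ.≤-pred (ℕ.≤∧≢⇒< m≤1+n m≢1+n)

∑-single : ∀ {n} {f : ℕ → ℤ} {c} → c ∈[1, n ] → (∀ i → i ∈[1, n ] → i ≢ c → f i ≡ 0ℤ) → ∑ n f ≡ f c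
∑-single {zero}          (() , z≤n) _
∑-single {suc n} {f} {c} (1≤c , c≤1+n) others with c ℕ.≟ suc n
... | yes refl = trans (cong (ℤ._+ f c) (∑-zero n λ i r → others i (∈[1,]-suc r) (ℕ.<⇒≢ (s≤s (proj₂ r)))))
                       (ℤ.+-identityˡ _)
... | no  c≢1+n = trans (cong₂ ℤ._+_ (∑-single (1≤c , ℕ.≤-pred (ℕ.≤∧≢⇒< c≤1+n c≢1+n))
                                               (λ i r → others i (∈[1,]-suc r)))
                                     (others (suc n) ∈[1,]-top (c≢1+n ∘ sym)))
                        (ℤ.+-identityʳ _)

∑-head : ∀ n (f : ℕ → ℤ) → ∑ (suc n) f ≡ f 1 ℤ.+ ∑[ i ≤ n ] f (suc i)
∑-head zero    f = trans (ℤ.+-identityˡ (f 1)) (sym (ℤ.+-identityʳ (f 1)))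
∑-head (suc n) f = trans (cong (ℤ._+ f (suc (suc n))) (∑-head n f)) (ℤ.+-assoc (f 1) _ _)

∑-neg : ∀ n (f : ℕ → ℤ) → ∑[ i ≤ n ] (- f i) ≡ - ∑ n f
∑-neg zero    f = refl
∑-neg (suc n) f = trans (cong (ℤ._+ (- f (suc n))) (∑-neg n f)) (sym (ℤ.neg-distrib-+ (∑ n f) (f (suc n))))

⟦_⟧ : ∀ {a} {A : Set a} → Dec A → ℤ
⟦ d ⟧ = if does d then 1ℤ else 0ℤ

module _ {a} {A : Set a} where

  ⟦⟧-yes : (d : Dec A) → A → ⟦ d ⟧ ≡ 1ℤ
  ⟦⟧-yes (yes _) _ = refl
  ⟦⟧-yes (no ¬a) a = contradiction a ¬a

  ⟦⟧-no : (d : Dec A) → ¬ A → ⟦ d ⟧ ≡ 0ℤ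
  ⟦⟧-no (yes a) ¬a = contradiction a ¬a
  ⟦⟧-no (no _)  _  = refl

  ⟦⟧+⟦¬⟧≡1 : (d : Dec A) → ⟦ d ⟧ ℤ.+ ⟦ ¬? d ⟧ ≡ 1ℤ
  ⟦⟧+⟦¬⟧≡1 (yes _) = refl
  ⟦⟧+⟦¬⟧≡1 (no _)  = refl

  0≤⟦⟧ : (d : Dec A) → 0ℤ ℤ.≤ ⟦ d ⟧
  0≤⟦⟧ (yes _) = +≤+ z≤n
  0≤⟦⟧ (no _)  = +≤+ z≤n

  ⟦⟧≤1 : (d : Dec A) → ⟦ d ⟧ ℤ.≤ 1ℤ
  ⟦⟧≤1 (yes _) = ℤ.≤-refl
  ⟦⟧≤1 (no _)  = +≤+ z≤n

  ⟦⟧*-cong : (d : Dec A) {x y : ℤ} → (A → x ≡ y) → ⟦ d ⟧ ℤ.* x ≡ ⟦ d ⟧ ℤ.* y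
  ⟦⟧*-cong (yes a) eq = cong (1ℤ ℤ.*_) (eq a)
  ⟦⟧*-cong (no _)  _  = refl

  ⟦⟧*-mono : (d : Dec A) {x y : ℤ} → (A → x ℤ.≤ y) → ⟦ d ⟧ ℤ.* x ℤ.≤ ⟦ d ⟧ ℤ.* y
  ⟦⟧*-mono (yes a) le = ℤ.*-monoˡ-≤-nonNeg 1ℤ (le a)
  ⟦⟧*-mono (no _)  _  = ℤ.≤-refl

  ⟦⟧*-no : (d : Dec A) (x : ℤ) → ¬ A → ⟦ d ⟧ ℤ.* x ≡ 0ℤ
  ⟦⟧*-no d x ¬a = trans (cong (ℤ._* x) (⟦⟧-no d ¬a)) (ℤ.*-zeroˡ x)

module _ {a b} {A : Set a} {B : Set b} where

  ⟦⟧-cong : (d : Dec A) (e : Dec B) → (A → B) → (B → A) → ⟦ d ⟧ ≡ ⟦ e ⟧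
  ⟦⟧-cong (yes _) (yes _) _  _    = refl
  ⟦⟧-cong (yes a) (no ¬b)  to _    = contradiction (to a) ¬b
  ⟦⟧-cong (no ¬a) (yes b)  _  from = contradiction (from b) ¬a
  ⟦⟧-cong (no _)  (no _)   _  _    = refl

  ⟦⟧-× : (d : Dec A) (e : Dec B) → ⟦ d ×-dec e ⟧ ≡ ⟦ d ⟧ ℤ.* ⟦ e ⟧
  ⟦⟧-× (yes _) (yes _) = refl
  ⟦⟧-× (yes _) (no _)  = refl
  ⟦⟧-× (no _)  _       = refl

sumℤ : List ℤ → ℤ
sumℤ = foldr ℤ._+_ 0ℤ

sumℤ-++ : ∀ xs ys → sumℤ (xs ++ ys) ≡ sumℤ xs ℤ.+ sumℤ ys
sumℤ-++ []       ys = sym (ℤ.+-identityˡ _)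
sumℤ-++ (x ∷ xs) ys = trans (cong (λ s → x ℤ.+ s) (sumℤ-++ xs ys)) (sym (ℤ.+-assoc x _ _))

sumℤ-range1 : ∀ n (f : ℕ → ℤ) → sumℤ (map f (range1 n)) ≡ ∑ n f
sumℤ-range1 zero    f = refl
sumℤ-range1 (suc n) f = begin
  sumℤ (map f (map suc (upTo (suc n))))
    ≡⟨ cong (λ xs → sumℤ (map f (map suc xs))) (List.upTo-∷ʳ n) ⟨
  sumℤ (map f (map suc (upTo n ++ n ∷ [])))
    ≡⟨ cong sumℤ (trans (cong (map f) (List.map-++ suc (upTo n) (n ∷ []))) (List.map-++ f (range1 n) (suc n ∷ []))) ⟩
  sumℤ (map f (range1 n) ++ f (suc n) ∷ [])
    ≡⟨ sumℤ-++ (map f (range1 n)) (f (suc n) ∷ []) ⟩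
  sumℤ (map f (range1 n)) ℤ.+ (f (suc n) ℤ.+ 0ℤ)
    ≡⟨ cong₂ ℤ._+_ (sumℤ-range1 n f) (ℤ.+-identityʳ (f (suc n))) ⟩
  ∑ (suc n) f ∎
  where open ≡-Reasoning

module _ {A : Set} {p} {P : A → Set p} (P? : ∀ x → Dec (P x)) where

  length-filter : ∀ xs → + length (filter P? xs) ≡ sumℤ (map (λ x → ⟦ P? x ⟧) xs)
  length-filter []       = refl
  length-filter (x ∷ xs) with does (P? x)
  ... | true  = trans (ℤ.pos-+ 1 _) (cong (λ s → 1ℤ ℤ.+ s) (length-filter xs))
  ... | false = trans (length-filter xs) (sym (ℤ.+-identityˡ _))

  sum-filter : ∀ (m : A → ℕ) xs → + sum (map m (filter P? xs)) ≡ sumℤ (map (λ x → ⟦ P? x ⟧ ℤ.* + m x) xs)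
  sum-filter m []       = refl
  sum-filter m (x ∷ xs) with does (P? x)
  ... | true  = trans (ℤ.pos-+ (m x) _) (cong₂ ℤ._+_ (sym (ℤ.*-identityˡ (+ m x))) (sum-filter m xs))
  ... | false = trans (sum-filter m xs) (sym (ℤ.+-identityˡ _))

sumℤ-concatMap : ∀ {A : Set} (F : A → List ℤ) xs → sumℤ (concatMap F xs) ≡ sumℤ (map (sumℤ ∘ F) xs)
sumℤ-concatMap F []       = refl
sumℤ-concatMap F (x ∷ xs) = trans (sumℤ-++ (F x) (concatMap F xs)) (cong (λ s → sumℤ (F x) ℤ.+ s) (sumℤ-concatMap F xs))

-- Dirichlet convolution

pairSum : ℕ → (ℕ → ℕ → ℤ) → ℤ
pairSum n F = ∑[ d ≤ n ] ∑[ e ≤ n ] (⟦ d * e ≟ n ⟧ ℤ.* F d e)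

dirichlet≡pairSum : ∀ f h n → dirichlet f h n ≡ pairSum n (λ d e → f d ℤ.* h e)
dirichlet≡pairSum f h n = bridge
  where
  sumℤ-range1² : ∀ n (X Y : ℕ → ℕ → ℤ) → (∀ d e → X d e ≡ Y d e) →
    sumℤ (concatMap (λ d → map (X d) (range1 n)) (range1 n)) ≡ ∑[ d ≤ n ] ∑[ e ≤ n ] Y d e
  sumℤ-range1² n X Y eq = begin
    sumℤ (concatMap (λ d → map (X d) (range1 n)) (range1 n))
      ≡⟨ sumℤ-concatMap (λ d → map (X d) (range1 n)) (range1 n) ⟩
    sumℤ (map (λ d → sumℤ (map (X d) (range1 n))) (range1 n))
      ≡⟨ sumℤ-range1 n _ ⟩
    ∑[ d ≤ n ] sumℤ (map (X d) (range1 n))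
      ≡⟨ ∑-cong n (λ d _ → trans (sumℤ-range1 n (X d)) (∑-cong n λ e _ → eq d e)) ⟩
    ∑[ d ≤ n ] ∑[ e ≤ n ] Y d e ∎
    where open ≡-Reasoning
  -- The left side of term≡ is the local term of Defs.dirichlet, which has no name: it is inferred
  -- from the use in bridge, and the case split is on `d * e ≟ n` in the unfolded form it takes there.
  mutual
    bridge : dirichlet f h n ≡ pairSum n (λ d e → f d ℤ.* h e)
    bridge = sumℤ-range1² n _ _ term≡
    term≡ : ∀ d e → _ ≡ ⟦ d * e ≟ n ⟧ ℤ.* (f d ℤ.* h e)
    term≡ d e with map′ (ℕ.≡ᵇ⇒≡ (d * e) n) (ℕ.≡⇒≡ᵇ (d * e) n) ((d * e ℕ.≡ᵇ n) because T-reflects (d * e ℕ.≡ᵇ n))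
    ... | yes de≡n = sym (trans (cong (ℤ._* (f d ℤ.* h e)) (⟦⟧-yes (d * e ≟ n) de≡n)) (ℤ.*-identityˡ (f d ℤ.* h e)))
    ... | no  de≢n = sym (trans (cong (ℤ._* (f d ℤ.* h e)) (⟦⟧-no (d * e ≟ n) de≢n)) (ℤ.*-zeroˡ (f d ℤ.* h e)))

*≡⇒∈[1,]ˡ : ∀ {d e n} → 1 ≤ n → d * e ≡ n → d ∈[1, n ]
*≡⇒∈[1,]ˡ {zero}          () refl
*≡⇒∈[1,]ˡ {suc d} {zero}  1≤n de≡n = contradiction (trans (sym (ℕ.*-zeroʳ (suc d))) de≡n) (ℕ.>⇒≢ 1≤n ∘ sym)
*≡⇒∈[1,]ˡ {suc d} {suc e} _   refl = s≤s z≤n , ℕ.m≤m*n (suc d) (suc e)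

*≡⇒∈[1,]ʳ : ∀ {d e n} → 1 ≤ n → d * e ≡ n → e ∈[1, n ]
*≡⇒∈[1,]ʳ {d} {e} 1≤n de≡n = *≡⇒∈[1,]ˡ 1≤n (trans (ℕ.*-comm e d) de≡n)

∑-δ : ∀ n {c} (F : ℕ → ℤ) → 1 ≤ c → (∀ x → n < x → F x ≡ 0ℤ) →
      ∑[ x ≤ n ] (⟦ c ≟ x ⟧ ℤ.* F x) ≡ F c
∑-δ n {c} F 1≤c beyond with c ℕ.≤? n
... | yes c≤n = trans (∑-single (1≤c , c≤n) (λ x _ x≢c → ⟦⟧*-no (c ≟ x) (F x) (x≢c ∘ sym)))
                      (trans (cong (ℤ._* F c) (⟦⟧-yes (c ≟ c) refl)) (ℤ.*-identityˡ (F c)))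
... | no  c≰n = trans (∑-zero n (λ x r → ⟦⟧*-no (c ≟ x) (F x) λ { refl → c≰n (proj₂ r) }))
                      (sym (beyond c (ℕ.≰⇒> c≰n)))

∑-count : ∀ {n N} e → 1 ≤ n → n ≤ N → ∑[ d ≤ N ] ⟦ d * e ≟ n ⟧ ≡ ⟦ e ∣? n ⟧
∑-count {n} {N} e 1≤n n≤N with e ∣? n
... | yes (divides q n≡qe) = trans
  (∑-single (proj₁ q∈ , ℕ.≤-trans (proj₂ q∈) n≤N)
            (λ d _ d≢q → ⟦⟧-no (d * e ≟ n) (λ de≡n → d≢q (ℕ.*-cancelʳ-≡ d q e {{e≢0}} (trans de≡n n≡qe)))))
  (⟦⟧-yes (q * e ≟ n) (sym n≡qe))
  where
  q∈ : q ∈[1, n ]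
  q∈ = *≡⇒∈[1,]ˡ 1≤n (sym n≡qe)
  e≢0 : ℕ.NonZero e
  e≢0 = ℕ.≢-nonZero (λ { refl → ℕ.>⇒≢ 1≤n (trans n≡qe (ℕ.*-zeroʳ q)) })
... | no  e∤n = ∑-zero N (λ d _ → ⟦⟧-no (d * e ≟ n) (λ de≡n → e∤n (divides d (sym de≡n))))

pairSum-cong : ∀ n {F G : ℕ → ℕ → ℤ} → (∀ d e → d * e ≡ n → F d e ≡ G d e) → pairSum n F ≡ pairSum n G
pairSum-cong n eq = ∑-cong n λ d _ → ∑-cong n λ e _ → ⟦⟧*-cong (d * e ≟ n) (eq d e)

pairSum-mono-≤ : ∀ n {F G : ℕ → ℕ → ℤ} → (∀ d e → d * e ≡ n → F d e ℤ.≤ G d e) → pairSum n F ℤ.≤ pairSum n G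
pairSum-mono-≤ n le = ∑-mono-≤ n λ d _ → ∑-mono-≤ n λ e _ → ⟦⟧*-mono (d * e ≟ n) (le d e)

pairSum-distrib-+ : ∀ n (F G : ℕ → ℕ → ℤ) → pairSum n (λ d e → F d e ℤ.+ G d e) ≡ pairSum n F ℤ.+ pairSum n G
pairSum-distrib-+ n F G = begin
  pairSum n (λ d e → F d e ℤ.+ G d e)
    ≡⟨ ∑-cong n (λ d _ → trans (∑-cong n λ e _ → ℤ.*-distribˡ-+ ⟦ d * e ≟ n ⟧ (F d e) (G d e))
                               (∑-distrib-+ n _ _)) ⟩
  ∑[ d ≤ n ] (∑[ e ≤ n ] (⟦ d * e ≟ n ⟧ ℤ.* F d e) ℤ.+ ∑[ e ≤ n ] (⟦ d * e ≟ n ⟧ ℤ.* G d e))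
    ≡⟨ ∑-distrib-+ n _ _ ⟩
  pairSum n F ℤ.+ pairSum n G ∎
  where open ≡-Reasoning

*-distribˡ-pairSum : ∀ c n (F : ℕ → ℕ → ℤ) → c ℤ.* pairSum n F ≡ pairSum n (λ d e → c ℤ.* F d e)
*-distribˡ-pairSum c n F = begin
  c ℤ.* pairSum n F
    ≡⟨ *-distribˡ-∑ c n _ ⟩
  ∑[ d ≤ n ] (c ℤ.* ∑[ e ≤ n ] (⟦ d * e ≟ n ⟧ ℤ.* F d e))
    ≡⟨ ∑-cong n (λ d _ → trans (*-distribˡ-∑ c n _) (∑-cong n λ e _ → swap c ⟦ d * e ≟ n ⟧ (F d e))) ⟩
  pairSum n (λ d e → c ℤ.* F d e) ∎
  where
  open ≡-Reasoning
  swap : ∀ a b x → a ℤ.* (b ℤ.* x) ≡ b ℤ.* (a ℤ.* x)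
  swap = solve-∀

*-distribʳ-pairSum : ∀ c n (F : ℕ → ℕ → ℤ) → pairSum n F ℤ.* c ≡ pairSum n (λ d e → F d e ℤ.* c)
*-distribʳ-pairSum c n F = begin
  pairSum n F ℤ.* c                ≡⟨ ℤ.*-comm (pairSum n F) c ⟩
  c ℤ.* pairSum n F                ≡⟨ *-distribˡ-pairSum c n F ⟩
  pairSum n (λ d e → c ℤ.* F d e)  ≡⟨ pairSum-cong n (λ d e _ → ℤ.*-comm c (F d e)) ⟩
  pairSum n (λ d e → F d e ℤ.* c)  ∎
  where open ≡-Reasoning

pairSum-swap : ∀ n (F : ℕ → ℕ → ℤ) → pairSum n F ≡ pairSum n (λ d e → F e d)
pairSum-swap n F = trans (∑-comm n n _)
  (∑-cong n λ d _ → ∑-cong n λ e _ → cong (ℤ._* F e d)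
    (⟦⟧-cong (e * d ≟ n) (d * e ≟ n) (trans (ℕ.*-comm d e)) (trans (ℕ.*-comm e d))))

pairSum-extend : ∀ {n N} (F : ℕ → ℕ → ℤ) → 1 ≤ n → n ≤ N →
                 pairSum n F ≡ ∑[ d ≤ N ] ∑[ e ≤ N ] (⟦ d * e ≟ n ⟧ ℤ.* F d e)
pairSum-extend {n} {N} F 1≤n n≤N = sym (trans
  (∑-shrink n≤N λ d n<d _ → ∑-zero N λ e _ → ⟦⟧*-no (d * e ≟ n) (F d e) λ de≡n → ℕ.<⇒≱ n<d (proj₂ (*≡⇒∈[1,]ˡ 1≤n de≡n)))
  (∑-cong n λ d _ → ∑-shrink n≤N λ e n<e _ → ⟦⟧*-no (d * e ≟ n) (F d e) λ de≡n → ℕ.<⇒≱ n<e (proj₂ (*≡⇒∈[1,]ʳ {d} 1≤n de≡n))))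

divisorSum : ℕ → (ℕ → ℤ) → ℤ
divisorSum n A = ∑[ d ≤ n ] (⟦ d ∣? n ⟧ ℤ.* A d)

pairSum≡divisorSum : ∀ {n} (A : ℕ → ℤ) → 1 ≤ n → pairSum n (λ d e → A e) ≡ divisorSum n A
pairSum≡divisorSum {n} A 1≤n = trans (∑-comm n n _) (∑-cong n λ e _ → begin
  ∑[ d ≤ n ] (⟦ d * e ≟ n ⟧ ℤ.* A e) ≡⟨ *-distribʳ-∑ (A e) n _ ⟨
  ∑[ d ≤ n ] ⟦ d * e ≟ n ⟧ ℤ.* A e   ≡⟨ cong (ℤ._* A e) (∑-count e 1≤n ℕ.≤-refl) ⟩
  ⟦ e ∣? n ⟧ ℤ.* A e                 ∎)
  where open ≡-Reasoning

∑-reorder₄ : ∀ n (X : ℕ → ℕ → ℕ → ℕ → ℤ) →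
  ∑[ d ≤ n ] ∑[ c ≤ n ] ∑[ a ≤ n ] ∑[ b ≤ n ] X d c a b ≡ ∑[ a ≤ n ] ∑[ b ≤ n ] ∑[ c ≤ n ] ∑[ d ≤ n ] X d c a b
∑-reorder₄ n X = begin
  ∑[ d ≤ n ] ∑[ c ≤ n ] ∑[ a ≤ n ] ∑[ b ≤ n ] X d c a b ≡⟨ ∑-comm n n _ ⟩
  ∑[ c ≤ n ] ∑[ d ≤ n ] ∑[ a ≤ n ] ∑[ b ≤ n ] X d c a b ≡⟨ ∑-cong n (λ c _ → ∑-comm n n _) ⟩
  ∑[ c ≤ n ] ∑[ a ≤ n ] ∑[ d ≤ n ] ∑[ b ≤ n ] X d c a b ≡⟨ ∑-cong n (λ c _ → ∑-cong n λ a _ → ∑-comm n n _) ⟩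
  ∑[ c ≤ n ] ∑[ a ≤ n ] ∑[ b ≤ n ] ∑[ d ≤ n ] X d c a b ≡⟨ ∑-comm n n _ ⟩
  ∑[ a ≤ n ] ∑[ c ≤ n ] ∑[ b ≤ n ] ∑[ d ≤ n ] X d c a b ≡⟨ ∑-cong n (λ a _ → ∑-comm n n _) ⟩
  ∑[ a ≤ n ] ∑[ b ≤ n ] ∑[ c ≤ n ] ∑[ d ≤ n ] X d c a b ∎
  where open ≡-Reasoning

∑-reverse₃ : ∀ n (X : ℕ → ℕ → ℕ → ℤ) →
  ∑[ a ≤ n ] ∑[ b ≤ n ] ∑[ c ≤ n ] X a b c ≡ ∑[ c ≤ n ] ∑[ b ≤ n ] ∑[ a ≤ n ] X a b c
∑-reverse₃ n X = begin
  ∑[ a ≤ n ] ∑[ b ≤ n ] ∑[ c ≤ n ] X a b c ≡⟨ ∑-cong n (λ a _ → ∑-comm n n _) ⟩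
  ∑[ a ≤ n ] ∑[ c ≤ n ] ∑[ b ≤ n ] X a b c ≡⟨ ∑-comm n n _ ⟩
  ∑[ c ≤ n ] ∑[ a ≤ n ] ∑[ b ≤ n ] X a b c ≡⟨ ∑-cong n (λ c _ → ∑-comm n n _) ⟩
  ∑[ c ≤ n ] ∑[ b ≤ n ] ∑[ a ≤ n ] X a b c ∎
  where open ≡-Reasoning

pairSum-nestˡ : ∀ n (F : ℕ → ℕ → ℕ → ℤ) → 1 ≤ n →
  pairSum n (λ d c → pairSum d (λ a b → F a b c)) ≡ ∑[ a ≤ n ] ∑[ b ≤ n ] ∑[ c ≤ n ] (⟦ a * b * c ≟ n ⟧ ℤ.* F a b c)
pairSum-nestˡ n F 1≤n = begin
  ∑[ d ≤ n ] ∑[ c ≤ n ] (⟦ d * c ≟ n ⟧ ℤ.* pairSum d (λ a b → F a b c))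
    ≡⟨ ∑-cong n (λ d _ → ∑-cong n λ c _ → ⟦⟧*-cong (d * c ≟ n) λ dc≡n →
         pairSum-extend _ (proj₁ (*≡⇒∈[1,]ˡ 1≤n dc≡n)) (proj₂ (*≡⇒∈[1,]ˡ 1≤n dc≡n))) ⟩
  ∑[ d ≤ n ] ∑[ c ≤ n ] (⟦ d * c ≟ n ⟧ ℤ.* ∑[ a ≤ n ] ∑[ b ≤ n ] (⟦ a * b ≟ d ⟧ ℤ.* F a b c))
    ≡⟨ ∑-cong n (λ d _ → ∑-cong n λ c _ → trans (*-distribˡ-∑ ⟦ d * c ≟ n ⟧ n _)
                                                  (∑-cong n λ a _ → *-distribˡ-∑ ⟦ d * c ≟ n ⟧ n _)) ⟩
  ∑[ d ≤ n ] ∑[ c ≤ n ] ∑[ a ≤ n ] ∑[ b ≤ n ] (⟦ d * c ≟ n ⟧ ℤ.* (⟦ a * b ≟ d ⟧ ℤ.* F a b c))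
    ≡⟨ ∑-reorder₄ n _ ⟩
  ∑[ a ≤ n ] ∑[ b ≤ n ] ∑[ c ≤ n ] ∑[ d ≤ n ] (⟦ d * c ≟ n ⟧ ℤ.* (⟦ a * b ≟ d ⟧ ℤ.* F a b c))
    ≡⟨ ∑-cong n (λ a ra → ∑-cong n λ b rb → ∑-cong n λ c rc → collapse a b c ra rb rc) ⟩
  ∑[ a ≤ n ] ∑[ b ≤ n ] ∑[ c ≤ n ] (⟦ a * b * c ≟ n ⟧ ℤ.* F a b c) ∎
  where
  open ≡-Reasoning
  swap : ∀ x y z → x ℤ.* (y ℤ.* z) ≡ y ℤ.* (x ℤ.* z)
  swap = solve-∀
  collapse : ∀ a b c → a ∈[1, n ] → b ∈[1, n ] → c ∈[1, n ] →
    ∑[ d ≤ n ] (⟦ d * c ≟ n ⟧ ℤ.* (⟦ a * b ≟ d ⟧ ℤ.* F a b c)) ≡ ⟦ a * b * c ≟ n ⟧ ℤ.* F a b c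
  collapse a b c (1≤a , _) (1≤b , _) (1≤c , _) =
    trans (∑-cong n λ d _ → swap ⟦ d * c ≟ n ⟧ ⟦ a * b ≟ d ⟧ (F a b c))
          (∑-δ n (λ d → ⟦ d * c ≟ n ⟧ ℤ.* F a b c) (ℕ.*-mono-≤ 1≤a 1≤b)
               λ d n<d → ⟦⟧*-no (d * c ≟ n) (F a b c) λ dc≡n → ℕ.<⇒≱ n<d (proj₂ (*≡⇒∈[1,]ˡ 1≤n dc≡n)))

pairSum-nestʳ : ∀ n (F : ℕ → ℕ → ℕ → ℤ) → 1 ≤ n →
  pairSum n (λ a e → pairSum e (λ b c → F a b c)) ≡ ∑[ a ≤ n ] ∑[ b ≤ n ] ∑[ c ≤ n ] (⟦ a * (b * c) ≟ n ⟧ ℤ.* F a b c)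
pairSum-nestʳ n F 1≤n = begin
  pairSum n (λ a e → pairSum e (λ b c → F a b c))
    ≡⟨ pairSum-swap n _ ⟩
  pairSum n (λ e a → pairSum e (λ b c → F a b c))
    ≡⟨ ∑-cong n (λ e _ → ∑-cong n λ a _ → cong (⟦ e * a ≟ n ⟧ ℤ.*_) (pairSum-swap e _)) ⟩
  pairSum n (λ e a → pairSum e (λ c b → F a b c))
    ≡⟨ pairSum-nestˡ n (λ c b a → F a b c) 1≤n ⟩
  ∑[ c ≤ n ] ∑[ b ≤ n ] ∑[ a ≤ n ] (⟦ c * b * a ≟ n ⟧ ℤ.* F a b c)
    ≡⟨ ∑-reverse₃ n _ ⟨
  ∑[ a ≤ n ] ∑[ b ≤ n ] ∑[ c ≤ n ] (⟦ c * b * a ≟ n ⟧ ℤ.* F a b c)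
    ≡⟨ ∑-cong n (λ a _ → ∑-cong n λ b _ → ∑-cong n λ c _ → cong (ℤ._* F a b c)
         (⟦⟧-cong (c * b * a ≟ n) (a * (b * c) ≟ n) (trans (reverse a b c)) (trans (sym (reverse a b c))))) ⟩
  ∑[ a ≤ n ] ∑[ b ≤ n ] ∑[ c ≤ n ] (⟦ a * (b * c) ≟ n ⟧ ℤ.* F a b c) ∎
  where
  open ≡-Reasoning
  reverse : ∀ a b c → a * (b * c) ≡ c * b * a
  reverse = ℕ-solve-∀

infixl 7 _⋆_
_⋆_ : (ℕ → ℤ) → (ℕ → ℤ) → ℕ → ℤ
(f ⋆ h) n = pairSum n (λ d e → f d ℤ.* h e)

⋆-assoc : ∀ f₁ f₂ f₃ n → 1 ≤ n → ((f₁ ⋆ f₂) ⋆ f₃) n ≡ (f₁ ⋆ (f₂ ⋆ f₃)) n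
⋆-assoc f₁ f₂ f₃ n 1≤n = begin
  pairSum n (λ d c → (f₁ ⋆ f₂) d ℤ.* f₃ c)
    ≡⟨ pairSum-cong n (λ d c _ → *-distribʳ-pairSum (f₃ c) d _) ⟩
  pairSum n (λ d c → pairSum d (λ a b → f₁ a ℤ.* f₂ b ℤ.* f₃ c))
    ≡⟨ pairSum-nestˡ n _ 1≤n ⟩
  ∑[ a ≤ n ] ∑[ b ≤ n ] ∑[ c ≤ n ] (⟦ a * b * c ≟ n ⟧ ℤ.* (f₁ a ℤ.* f₂ b ℤ.* f₃ c))
    ≡⟨ ∑-cong n (λ a _ → ∑-cong n λ b _ → ∑-cong n λ c _ → cong₂ ℤ._*_
         (⟦⟧-cong (a * b * c ≟ n) (a * (b * c) ≟ n) (trans (sym (ℕ.*-assoc a b c))) (trans (ℕ.*-assoc a b c)))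
         (ℤ.*-assoc (f₁ a) (f₂ b) (f₃ c))) ⟩
  ∑[ a ≤ n ] ∑[ b ≤ n ] ∑[ c ≤ n ] (⟦ a * (b * c) ≟ n ⟧ ℤ.* (f₁ a ℤ.* (f₂ b ℤ.* f₃ c)))
    ≡⟨ pairSum-nestʳ n _ 1≤n ⟨
  pairSum n (λ a e → pairSum e (λ b c → f₁ a ℤ.* (f₂ b ℤ.* f₃ c)))
    ≡⟨ pairSum-cong n (λ a e _ → *-distribˡ-pairSum (f₁ a) e _) ⟨
  (f₁ ⋆ (f₂ ⋆ f₃)) n ∎
  where open ≡-Reasoning

⋆-comm : ∀ f h n → (f ⋆ h) n ≡ (h ⋆ f) n
⋆-comm f h n = trans (pairSum-swap n _) (pairSum-cong n λ d e _ → ℤ.*-comm (f e) (h d))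

⋆-cong : ∀ {f f′ h h′} n → 1 ≤ n → (∀ d → d ∈[1, n ] → f d ≡ f′ d) → (∀ e → e ∈[1, n ] → h e ≡ h′ e) →
         (f ⋆ h) n ≡ (f′ ⋆ h′) n
⋆-cong n 1≤n f≗f′ h≗h′ = pairSum-cong n λ d e de≡n →
  cong₂ ℤ._*_ (f≗f′ d (*≡⇒∈[1,]ˡ 1≤n de≡n)) (h≗h′ e (*≡⇒∈[1,]ʳ {d} 1≤n de≡n))

⋆-distribʳ-+ : ∀ f f′ h n → ((λ x → f x ℤ.+ f′ x) ⋆ h) n ≡ (f ⋆ h) n ℤ.+ (f′ ⋆ h) n
⋆-distribʳ-+ f f′ h n = trans (pairSum-cong n λ d e _ → ℤ.*-distribʳ-+ (h e) (f d) (f′ d)) (pairSum-distrib-+ n _ _)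

⋆-distribˡ-+ : ∀ f h h′ n → (f ⋆ (λ x → h x ℤ.+ h′ x)) n ≡ (f ⋆ h) n ℤ.+ (f ⋆ h′) n
⋆-distribˡ-+ f h h′ n = trans (pairSum-cong n λ d e _ → ℤ.*-distribˡ-+ (f d) (h e) (h′ e)) (pairSum-distrib-+ n _ _)

𝟏 : ℕ → ℤ
𝟏 _ = 1ℤ

𝟏⋆≡divisorSum : ∀ A {n} → 1 ≤ n → (𝟏 ⋆ A) n ≡ divisorSum n A
𝟏⋆≡divisorSum A {n} 1≤n = trans (pairSum-cong n λ d e _ → ℤ.*-identityˡ (A e)) (pairSum≡divisorSum A 1≤n)

divisorSum-injective : ∀ A B → (∀ n → 1 ≤ n → divisorSum n A ≡ divisorSum n B) → ∀ n → 1 ≤ n → A n ≡ B n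
divisorSum-injective A B eq = <-rec (λ n → 1 ≤ n → A n ≡ B n) step
  where
  step : ∀ n → (∀ {m} → m < n → 1 ≤ m → A m ≡ B m) → 1 ≤ n → A n ≡ B n
  step n ih 1≤n = ℤ.i-j≡0⇒i≡j (A n) (B n) (begin
    A n ℤ.+ (- B n)
      ≡⟨ trans (cong (ℤ._* (A n ℤ.+ (- B n))) (⟦⟧-yes (n ∣? n) ∣-refl)) (ℤ.*-identityˡ (A n ℤ.+ (- B n))) ⟨
    ⟦ n ∣? n ⟧ ℤ.* (A n ℤ.+ (- B n))
      ≡⟨ ∑-single (1≤n , ℕ.≤-refl) (λ d (1≤d , d≤n) d≢n →
           trans (cong (λ x → ⟦ d ∣? n ⟧ ℤ.* (x ℤ.+ (- B d))) (ih (ℕ.≤∧≢⇒< d≤n d≢n) 1≤d))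
                 (trans (cong (λ x → ⟦ d ∣? n ⟧ ℤ.* x) (ℤ.+-inverseʳ (B d))) (ℤ.*-zeroʳ ⟦ d ∣? n ⟧))) ⟨
    ∑[ d ≤ n ] (⟦ d ∣? n ⟧ ℤ.* (A d ℤ.+ (- B d)))
      ≡⟨ ∑-cong n (λ d _ → ℤ.*-distribˡ-+ ⟦ d ∣? n ⟧ (A d) (- B d)) ⟩
    ∑[ d ≤ n ] (⟦ d ∣? n ⟧ ℤ.* A d ℤ.+ ⟦ d ∣? n ⟧ ℤ.* (- B d))
      ≡⟨ ∑-distrib-+ n _ _ ⟩
    divisorSum n A ℤ.+ ∑[ d ≤ n ] (⟦ d ∣? n ⟧ ℤ.* (- B d))
      ≡⟨ cong₂ ℤ._+_ (eq n 1≤n) (∑-cong n λ d _ → sym (ℤ.neg-distribʳ-* ⟦ d ∣? n ⟧ (B d))) ⟩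
    divisorSum n B ℤ.+ ∑[ d ≤ n ] (- (⟦ d ∣? n ⟧ ℤ.* B d))
      ≡⟨ cong (λ x → divisorSum n B ℤ.+ x) (∑-neg n _) ⟩
    divisorSum n B ℤ.+ (- divisorSum n B)
      ≡⟨ ℤ.+-inverseʳ (divisorSum n B) ⟩
    0ℤ ∎)
    where open ≡-Reasoning

∑-multiples : ∀ n {c} (F : ℕ → ℤ) → 1 ≤ c → (∀ x → n < x → F x ≡ 0ℤ) →
              ∑[ x ≤ n ] (⟦ c ∣? x ⟧ ℤ.* F x) ≡ ∑[ y ≤ n ] F (y * c)
∑-multiples n {c} F 1≤c beyond = begin
  ∑[ x ≤ n ] (⟦ c ∣? x ⟧ ℤ.* F x)
    ≡⟨ ∑-cong n (λ x (1≤x , x≤n) → cong (ℤ._* F x) (∑-count c 1≤x x≤n)) ⟨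
  ∑[ x ≤ n ] (∑[ y ≤ n ] ⟦ y * c ≟ x ⟧ ℤ.* F x)
    ≡⟨ ∑-cong n (λ x _ → *-distribʳ-∑ (F x) n _) ⟩
  ∑[ x ≤ n ] ∑[ y ≤ n ] (⟦ y * c ≟ x ⟧ ℤ.* F x)
    ≡⟨ ∑-comm n n _ ⟩
  ∑[ y ≤ n ] ∑[ x ≤ n ] (⟦ y * c ≟ x ⟧ ℤ.* F x)
    ≡⟨ ∑-cong n (λ y (1≤y , _) → ∑-δ n F (ℕ.*-mono-≤ 1≤y 1≤c) beyond) ⟩
  ∑[ y ≤ n ] F (y * c) ∎
  where open ≡-Reasoning

-- Prime factors, and the Liouville and Möbius functions

prime⇒≥2 : ∀ {p} → Prime p → 2 ≤ p
prime⇒≥2 {p} pp = ℕ.nonTrivial⇒n>1 p {{prime⇒nonTrivial pp}}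

prime⇒≥1 : ∀ {p} → Prime p → 1 ≤ p
prime⇒≥1 = ℕ.≤-trans (s≤s z≤n) ∘ prime⇒≥2

∃prime-factor : ∀ {n} → 2 ≤ n → ∃[ p ] ∃[ e ] (Prime p × p * e ≡ n)
∃prime-factor {1} (s≤s ())
∃prime-factor {n@(suc (suc _))} _ with factorise n
... | record { factors = [] ; isFactorisation = () }
... | record { factors = p ∷ ps ; isFactorisation = n≡p*ps ; factorsPrime = pp ∷ _ } = p , _ , pp , sym n≡p*ps

m<p*m : ∀ {p m} → Prime p → 1 ≤ m → m < p * m
m<p*m {p} {m} pp 1≤m = subst (m <_) (ℕ.*-comm m p) (ℕ.m<m*n m p {{ℕ.>-nonZero 1≤m}} (prime⇒≥2 pp))

prime-induction : (P : ℕ → Set) → P 1 →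
                  (∀ {p n} → Prime p → 1 ≤ n → (∀ {q m} → Prime q → q * m ≡ p * n → P m) → P (p * n)) →
                  ∀ n → 1 ≤ n → P n
prime-induction P base step = <-rec (λ n → 1 ≤ n → P n) go
  where
  go : ∀ n → (∀ {m} → m < n → 1 ≤ m → P m) → 1 ≤ n → P n
  go 1                  _  _   = base
  go n@(suc (suc _)) ih 1≤n with ∃prime-factor {n} (s≤s (s≤s z≤n))
  ... | p , m , pp , pm≡n = subst P pm≡n (step pp (cofactor-pos pp pm≡n) λ pq qk≡pm → cofactor pq (trans qk≡pm pm≡n))
    where
    cofactor-pos : ∀ {q k} → Prime q → q * k ≡ n → 1 ≤ k
    cofactor-pos {q} _ qk≡n = proj₁ (*≡⇒∈[1,]ʳ {q} 1≤n qk≡n)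
    cofactor : ∀ {q k} → Prime q → q * k ≡ n → P k
    cofactor {q} {k} pq qk≡n = ih (subst (k <_) qk≡n (m<p*m pq (cofactor-pos pq qk≡n))) (cofactor-pos pq qk≡n)

ℙ : ℕ → ℤ
ℙ p = ⟦ prime? p ⟧

ω≡divisorSum : ∀ n → + ω n ≡ divisorSum n ℙ
ω≡divisorSum n = begin
  + ω n
    ≡⟨ length-filter (λ p → prime? p ×-dec p ∣? n) (range1 n) ⟩
  sumℤ (map (λ p → ⟦ prime? p ×-dec p ∣? n ⟧) (range1 n))
    ≡⟨ sumℤ-range1 n _ ⟩
  ∑[ p ≤ n ] ⟦ prime? p ×-dec p ∣? n ⟧
    ≡⟨ ∑-cong n (λ p _ → trans (⟦⟧-× (prime? p) (p ∣? n)) (ℤ.*-comm (ℙ p) _)) ⟩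
  divisorSum n ℙ ∎
  where open ≡-Reasoning

ℙ⋆𝟏≡ω : ∀ {n} → 1 ≤ n → (ℙ ⋆ 𝟏) n ≡ + ω n
ℙ⋆𝟏≡ω {n} 1≤n = trans (⋆-comm ℙ 𝟏 n) (trans (𝟏⋆≡divisorSum ℙ 1≤n) (sym (ω≡divisorSum n)))

multiplicity≡∑ : ∀ q n → + multiplicity q n ≡ ∑[ k ≤ n ] ⟦ q ^ k ∣? n ⟧
multiplicity≡∑ q n = trans (length-filter (λ k → q ^ k ∣? n) (range1 n)) (sumℤ-range1 n _)

multiplicity-∤ : ∀ {q n} → ¬ q ∣ n → multiplicity q n ≡ 0
multiplicity-∤ {q} {n} q∤n = ℤ.+-injective (trans (multiplicity≡∑ q n)
  (∑-zero n λ { (suc k) _ → ⟦⟧-no (q ^ suc k ∣? n) (q∤n ∘ ∣-trans (m∣m*n (q ^ k))) }))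

Ω≡∑ : ∀ n → + Ω n ≡ ∑[ q ≤ n ] (ℙ q ℤ.* + multiplicity q n)
Ω≡∑ n = begin
  + Ω n
    ≡⟨ sum-filter (λ q → prime? q ×-dec q ∣? n) (λ q → multiplicity q n) (range1 n) ⟩
  sumℤ (map (λ q → ⟦ prime? q ×-dec q ∣? n ⟧ ℤ.* + multiplicity q n) (range1 n))
    ≡⟨ sumℤ-range1 n _ ⟩
  ∑[ q ≤ n ] (⟦ prime? q ×-dec q ∣? n ⟧ ℤ.* + multiplicity q n)
    ≡⟨ ∑-cong n (λ q _ → drop-∣ q (q ∣? n)) ⟩
  ∑[ q ≤ n ] (ℙ q ℤ.* + multiplicity q n) ∎
  where
  open ≡-Reasoning
  drop-∣ : ∀ q → (q∣?n : Dec (q ∣ n)) → ⟦ prime? q ×-dec q∣?n ⟧ ℤ.* + multiplicity q n ≡ ℙ q ℤ.* + multiplicity q n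
  drop-∣ q (yes q∣n) = cong (ℤ._* + multiplicity q n) (trans (⟦⟧-× (prime? q) (yes q∣n)) (ℤ.*-identityʳ (ℙ q)))
  drop-∣ q (no  q∤n) = begin
    ⟦ prime? q ×-dec no q∤n ⟧ ℤ.* + multiplicity q n ≡⟨ cong (λ m → ⟦ prime? q ×-dec no q∤n ⟧ ℤ.* + m) (multiplicity-∤ q∤n) ⟩
    ⟦ prime? q ×-dec no q∤n ⟧ ℤ.* 0ℤ                 ≡⟨ ℤ.*-zeroʳ ⟦ prime? q ×-dec no q∤n ⟧ ⟩
    0ℤ                                               ≡⟨ ℤ.*-zeroʳ (ℙ q) ⟨
    ℙ q ℤ.* 0ℤ                                       ≡⟨ cong (λ m → ℙ q ℤ.* + m) (multiplicity-∤ q∤n) ⟨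
    ℙ q ℤ.* + multiplicity q n                       ∎

n<m^n : ∀ {m} n → 2 ≤ m → n < m ^ n
n<m^n zero    _   = s≤s z≤n
n<m^n {m} (suc n) 2≤m = ℕ.<-≤-trans (ℕ.≤-<-trans (n<m^n n 2≤m) (ℕ.m<m*n (m ^ n) m {{ℕ.m^n≢0 m n}} 2≤m))
                                   (ℕ.≤-reflexive (ℕ.*-comm (m ^ n) m))
  where
  instance
    m≢0 : ℕ.NonZero m
    m≢0 = ℕ.>-nonZero (ℕ.≤-trans (s≤s z≤n) 2≤m)

^∤ : ∀ {p n} k → 2 ≤ p → 1 ≤ n → n < k → ¬ p ^ k ∣ n
^∤ {p} {n} k 2≤p 1≤n n<k = >⇒∤ {{ℕ.>-nonZero 1≤n}} (ℕ.<-trans n<k (n<m^n k 2≤p))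

prime∤⇒coprime : ∀ {p n} → Prime p → ¬ p ∣ n → Coprime p n
prime∤⇒coprime pp p∤n (d∣p , d∣n) with prime⇒irreducible pp d∣p
... | inj₁ d≡1 = d≡1
... | inj₂ refl = contradiction d∣n p∤n

prime∤prime^ : ∀ {p q} k → Prime p → Prime q → q ≢ p → ¬ p ∣ q ^ k
prime∤prime^ zero    pp pq q≢p p∣1 = ¬prime[1] (subst Prime (∣1⇒≡1 p∣1) pp)
prime∤prime^ {p} {q} (suc k) pp pq q≢p p∣q^[1+k] with euclidsLemma q (q ^ k) pp p∣q^[1+k]
... | inj₂ p∣q^k = prime∤prime^ k pp pq q≢p p∣q^k
... | inj₁ p∣q with prime⇒irreducible pq p∣q
...   | inj₁ refl = ¬prime[1] pp
...   | inj₂ p≡q  = q≢p (sym p≡q)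

multiplicity-*-≢ : ∀ {p q e} → Prime p → Prime q → q ≢ p → 1 ≤ e → multiplicity q (p * e) ≡ multiplicity q e
multiplicity-*-≢ {p} {q} {e} pp pq q≢p 1≤e = ℤ.+-injective (begin
  + multiplicity q (p * e)      ≡⟨ multiplicity≡∑ q (p * e) ⟩
  ∑[ k ≤ p * e ] ⟦ q ^ k ∣? p * e ⟧
    ≡⟨ ∑-cong (p * e) (λ k _ → ⟦⟧-cong (q ^ k ∣? p * e) (q ^ k ∣? e) (coprime-divisor (q^k⊥p k)) (∣n⇒∣m*n p)) ⟩
  ∑[ k ≤ p * e ] ⟦ q ^ k ∣? e ⟧
    ≡⟨ ∑-shrink (ℕ.m≤n*m e p {{prime⇒nonZero pp}}) (λ k e<k _ → ⟦⟧-no (q ^ k ∣? e) (^∤ k (prime⇒≥2 pq) 1≤e e<k)) ⟩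
  ∑[ k ≤ e ] ⟦ q ^ k ∣? e ⟧     ≡⟨ multiplicity≡∑ q e ⟨
  + multiplicity q e            ∎)
  where
  open ≡-Reasoning
  q^k⊥p : ∀ k → Coprime (q ^ k) p
  q^k⊥p k = Coprime-sym (prime∤⇒coprime pp (prime∤prime^ k pp pq q≢p))

multiplicity-*-≡ : ∀ {p e} → Prime p → 1 ≤ e → multiplicity p (p * e) ≡ suc (multiplicity p e)
multiplicity-*-≡ {p} {e} pp 1≤e = ℤ.+-injective (go (p * e) refl)
  where
  open ≡-Reasoning
  instance
    p≢0 : ℕ.NonZero p
    p≢0 = prime⇒nonZero pp
  go : ∀ n → n ≡ p * e → + multiplicity p n ≡ + suc (multiplicity p e)
  go zero    0≡pe = contradiction 0≡pe (ℕ.<⇒≢ (ℕ.*-mono-≤ (prime⇒≥1 pp) 1≤e))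
  go (suc N) n≡pe = begin
    + multiplicity p (suc N)                    ≡⟨ multiplicity≡∑ p (suc N) ⟩
    ∑[ k ≤ suc N ] ⟦ p ^ k ∣? suc N ⟧           ≡⟨ ∑-head N _ ⟩
    ⟦ p ^ 1 ∣? suc N ⟧ ℤ.+ ∑[ k ≤ N ] ⟦ p ^ suc k ∣? suc N ⟧
      ≡⟨ cong₂ ℤ._+_ (⟦⟧-yes (p ^ 1 ∣? suc N) (subst (p ^ 1 ∣_) (sym n≡pe) (*-monoʳ-∣ p (1∣ e))))
                     (∑-cong N λ k _ → ⟦⟧-cong (p ^ suc k ∣? suc N) (p ^ k ∣? e)
                        (*-cancelˡ-∣ p ∘ subst (p ^ suc k ∣_) n≡pe) (subst (p ^ suc k ∣_) (sym n≡pe) ∘ *-monoʳ-∣ p)) ⟩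
    1ℤ ℤ.+ ∑[ k ≤ N ] ⟦ p ^ k ∣? e ⟧
      ≡⟨ cong (ℤ._+_ 1ℤ) (∑-shrink e≤N λ k e<k _ → ⟦⟧-no (p ^ k ∣? e) (^∤ k (prime⇒≥2 pp) 1≤e e<k)) ⟩
    1ℤ ℤ.+ ∑[ k ≤ e ] ⟦ p ^ k ∣? e ⟧            ≡⟨ cong (ℤ._+_ 1ℤ) (multiplicity≡∑ p e) ⟨
    1ℤ ℤ.+ + multiplicity p e                   ∎
    where
    e≤N : e ≤ N
    e≤N = ℕ.≤-pred (subst (e <_) (sym n≡pe) (m<p*m pp 1≤e))

prime∣p*n⇒∣n : ∀ {p q n} → Prime p → Prime q → q ≢ p → q ∣ p * n → q ∣ n
prime∣p*n⇒∣n {p} {q} {n} pp pq q≢p q∣pn with euclidsLemma p n pq q∣pn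
... | inj₂ q∣n = q∣n
... | inj₁ q∣p with prime⇒irreducible pp q∣p
...   | inj₁ refl = contradiction pq ¬prime[1]
...   | inj₂ q≡p  = contradiction q≡p q≢p

∑[q≤p*n]⟦p≟q⟧≡1 : ∀ {p n} → Prime p → 1 ≤ n → ∑[ q ≤ p * n ] ⟦ p ≟ q ⟧ ≡ 1ℤ
∑[q≤p*n]⟦p≟q⟧≡1 {p} {n} pp 1≤n =
  trans (∑-single (prime⇒≥1 pp , ℕ.m≤m*n p n {{ℕ.>-nonZero 1≤n}}) (λ q _ q≢p → ⟦⟧-no (p ≟ q) (q≢p ∘ sym)))
        (⟦⟧-yes (p ≟ p) refl)

Ω[p*n]≡1+Ω[n] : ∀ {p n} → Prime p → 1 ≤ n → Ω (p * n) ≡ suc (Ω n)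
Ω[p*n]≡1+Ω[n] {p} {n} pp 1≤n = ℤ.+-injective (begin
  + Ω (p * n)
    ≡⟨ Ω≡∑ (p * n) ⟩
  ∑[ q ≤ p * n ] (ℙ q ℤ.* + multiplicity q (p * n))
    ≡⟨ ∑-cong (p * n) (λ q _ → split q (q ≟ p)) ⟩
  ∑[ q ≤ p * n ] (ℙ q ℤ.* + multiplicity q n ℤ.+ ⟦ p ≟ q ⟧)
    ≡⟨ ∑-distrib-+ (p * n) _ _ ⟩
  ∑[ q ≤ p * n ] (ℙ q ℤ.* + multiplicity q n) ℤ.+ ∑[ q ≤ p * n ] ⟦ p ≟ q ⟧
    ≡⟨ cong₂ ℤ._+_ (∑-shrink (ℕ.m≤n*m n p {{prime⇒nonZero pp}}) λ q n<q _ →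
                      trans (cong (λ m → ℙ q ℤ.* + m) (multiplicity-∤ (>⇒∤ {{ℕ.>-nonZero 1≤n}} n<q))) (ℤ.*-zeroʳ (ℙ q)))
                   (∑[q≤p*n]⟦p≟q⟧≡1 pp 1≤n) ⟩
  ∑[ q ≤ n ] (ℙ q ℤ.* + multiplicity q n) ℤ.+ 1ℤ
    ≡⟨ cong (ℤ._+ 1ℤ) (Ω≡∑ n) ⟨
  + Ω n ℤ.+ 1ℤ
    ≡⟨ ℤ.+-comm (+ Ω n) 1ℤ ⟩
  + suc (Ω n) ∎)
  where
  open ≡-Reasoning
  split : ∀ q → Dec (q ≡ p) → ℙ q ℤ.* + multiplicity q (p * n) ≡ ℙ q ℤ.* + multiplicity q n ℤ.+ ⟦ p ≟ q ⟧
  split q (yes refl) = begin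
    ℙ p ℤ.* + multiplicity p (p * n)
      ≡⟨ cong₂ (λ x m → x ℤ.* + m) (⟦⟧-yes (prime? p) pp) (multiplicity-*-≡ pp 1≤n) ⟩
    1ℤ ℤ.* + suc (multiplicity p n)
      ≡⟨ trans (ℤ.*-identityˡ _) (cong +_ (ℕ.+-comm 1 (multiplicity p n))) ⟩
    + multiplicity p n ℤ.+ 1ℤ
      ≡⟨ cong (ℤ._+ 1ℤ) (ℤ.*-identityˡ (+ multiplicity p n)) ⟨
    1ℤ ℤ.* + multiplicity p n ℤ.+ 1ℤ
      ≡⟨ cong₂ (λ x y → x ℤ.* + multiplicity p n ℤ.+ y) (⟦⟧-yes (prime? p) pp) (⟦⟧-yes (p ≟ p) refl) ⟨
    ℙ p ℤ.* + multiplicity p n ℤ.+ ⟦ p ≟ p ⟧ ∎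
  split q (no q≢p) = begin
    ℙ q ℤ.* + multiplicity q (p * n)       ≡⟨ ⟦⟧*-cong (prime? q) (λ pq → cong +_ (multiplicity-*-≢ pp pq q≢p 1≤n)) ⟩
    ℙ q ℤ.* + multiplicity q n             ≡⟨ ℤ.+-identityʳ _ ⟨
    ℙ q ℤ.* + multiplicity q n ℤ.+ 0ℤ      ≡⟨ cong (ℤ._+_ (ℙ q ℤ.* + multiplicity q n)) (⟦⟧-no (p ≟ q) (q≢p ∘ sym)) ⟨
    ℙ q ℤ.* + multiplicity q n ℤ.+ ⟦ p ≟ q ⟧ ∎

+ω[p*n] : ∀ {p n} → Prime p → 1 ≤ n → + ω (p * n) ≡ + ω n ℤ.+ ⟦ ¬? (p ∣? n) ⟧
+ω[p*n] {p} {n} pp 1≤n = begin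
  + ω (p * n)
    ≡⟨ ω≡divisorSum (p * n) ⟩
  ∑[ q ≤ p * n ] (⟦ q ∣? p * n ⟧ ℤ.* ℙ q)
    ≡⟨ ∑-cong (p * n) (λ q _ → split q (q ≟ p)) ⟩
  ∑[ q ≤ p * n ] (⟦ q ∣? n ⟧ ℤ.* ℙ q ℤ.+ ⟦ p ≟ q ⟧ ℤ.* ⟦ ¬? (p ∣? n) ⟧)
    ≡⟨ ∑-distrib-+ (p * n) _ _ ⟩
  ∑[ q ≤ p * n ] (⟦ q ∣? n ⟧ ℤ.* ℙ q) ℤ.+ ∑[ q ≤ p * n ] (⟦ p ≟ q ⟧ ℤ.* ⟦ ¬? (p ∣? n) ⟧)
    ≡⟨ cong₂ ℤ._+_ (∑-shrink (ℕ.m≤n*m n p {{prime⇒nonZero pp}}) λ q n<q _ →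
                      ⟦⟧*-no (q ∣? n) (ℙ q) (>⇒∤ {{ℕ.>-nonZero 1≤n}} n<q))
                   (trans (sym (*-distribʳ-∑ ⟦ ¬? (p ∣? n) ⟧ (p * n) _))
                          (cong (ℤ._* ⟦ ¬? (p ∣? n) ⟧) (∑[q≤p*n]⟦p≟q⟧≡1 pp 1≤n))) ⟩
  divisorSum n ℙ ℤ.+ 1ℤ ℤ.* ⟦ ¬? (p ∣? n) ⟧
    ≡⟨ cong₂ ℤ._+_ (ω≡divisorSum n) (sym (ℤ.*-identityˡ _)) ⟨
  + ω n ℤ.+ ⟦ ¬? (p ∣? n) ⟧ ∎
  where
  open ≡-Reasoning
  split : ∀ q → Dec (q ≡ p) → ⟦ q ∣? p * n ⟧ ℤ.* ℙ q ≡ ⟦ q ∣? n ⟧ ℤ.* ℙ q ℤ.+ ⟦ p ≟ q ⟧ ℤ.* ⟦ ¬? (p ∣? n) ⟧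
  split q (yes refl) = begin
    ⟦ p ∣? p * n ⟧ ℤ.* ℙ p                   ≡⟨ cong₂ ℤ._*_ (⟦⟧-yes (p ∣? p * n) (m∣m*n n)) (⟦⟧-yes (prime? p) pp) ⟩
    1ℤ                                      ≡⟨ ⟦⟧+⟦¬⟧≡1 (p ∣? n) ⟨
    ⟦ p ∣? n ⟧ ℤ.+ ⟦ ¬? (p ∣? n) ⟧          ≡⟨ cong₂ ℤ._+_ (ℤ.*-identityʳ ⟦ p ∣? n ⟧) (ℤ.*-identityˡ ⟦ ¬? (p ∣? n) ⟧) ⟨
    ⟦ p ∣? n ⟧ ℤ.* 1ℤ ℤ.+ 1ℤ ℤ.* ⟦ ¬? (p ∣? n) ⟧
      ≡⟨ cong₂ (λ x y → ⟦ p ∣? n ⟧ ℤ.* x ℤ.+ y ℤ.* ⟦ ¬? (p ∣? n) ⟧) (⟦⟧-yes (prime? p) pp) (⟦⟧-yes (p ≟ p) refl) ⟨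
    ⟦ p ∣? n ⟧ ℤ.* ℙ p ℤ.+ ⟦ p ≟ p ⟧ ℤ.* ⟦ ¬? (p ∣? n) ⟧ ∎
  split q (no q≢p) = begin
    ⟦ q ∣? p * n ⟧ ℤ.* ℙ q
      ≡⟨ trans (ℤ.*-comm _ (ℙ q)) (trans (⟦⟧*-cong (prime? q) λ pq →
           ⟦⟧-cong (q ∣? p * n) (q ∣? n) (prime∣p*n⇒∣n pp pq q≢p) (∣n⇒∣m*n p)) (ℤ.*-comm (ℙ q) _)) ⟩
    ⟦ q ∣? n ⟧ ℤ.* ℙ q
      ≡⟨ ℤ.+-identityʳ _ ⟨
    ⟦ q ∣? n ⟧ ℤ.* ℙ q ℤ.+ 0ℤ
      ≡⟨ cong (ℤ._+_ (⟦ q ∣? n ⟧ ℤ.* ℙ q)) (⟦⟧*-no (p ≟ q) ⟦ ¬? (p ∣? n) ⟧ (q≢p ∘ sym)) ⟨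
    ⟦ q ∣? n ⟧ ℤ.* ℙ q ℤ.+ ⟦ p ≟ q ⟧ ℤ.* ⟦ ¬? (p ∣? n) ⟧ ∎

ω[p*n]≡ω[n] : ∀ {p n} → Prime p → 1 ≤ n → p ∣ n → ω (p * n) ≡ ω n
ω[p*n]≡ω[n] {p} {n} pp 1≤n p∣n = ℤ.+-injective (begin
  + ω (p * n)                  ≡⟨ +ω[p*n] pp 1≤n ⟩
  + ω n ℤ.+ ⟦ ¬? (p ∣? n) ⟧    ≡⟨ cong (ℤ._+_ (+ ω n)) (⟦⟧-no (¬? (p ∣? n)) (λ p∤n → p∤n p∣n)) ⟩
  + ω n ℤ.+ 0ℤ                 ≡⟨ ℤ.+-identityʳ (+ ω n) ⟩
  + ω n                        ∎)
  where open ≡-Reasoning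

ω[p*n]≡1+ω[n] : ∀ {p n} → Prime p → 1 ≤ n → ¬ p ∣ n → ω (p * n) ≡ suc (ω n)
ω[p*n]≡1+ω[n] {p} {n} pp 1≤n p∤n = ℤ.+-injective (begin
  + ω (p * n)                  ≡⟨ +ω[p*n] pp 1≤n ⟩
  + ω n ℤ.+ ⟦ ¬? (p ∣? n) ⟧    ≡⟨ cong (ℤ._+_ (+ ω n)) (⟦⟧-yes (¬? (p ∣? n)) p∤n) ⟩
  + ω n ℤ.+ 1ℤ                 ≡⟨ ℤ.+-comm (+ ω n) 1ℤ ⟩
  + suc (ω n)                  ∎)
  where open ≡-Reasoning

ω≤Ω : ∀ n → 1 ≤ n → ω n ≤ Ω n
ω≤Ω = prime-induction (λ n → ω n ≤ Ω n) z≤n step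
  where
  step : ∀ {p n} → Prime p → 1 ≤ n → (∀ {q m} → Prime q → q * m ≡ p * n → ω m ≤ Ω m) → ω (p * n) ≤ Ω (p * n)
  step {p} {n} pp 1≤n ih with p ∣? n
  ... | yes p∣n = subst₂ _≤_ (sym (ω[p*n]≡ω[n] pp 1≤n p∣n)) (sym (Ω[p*n]≡1+Ω[n] pp 1≤n)) (ℕ.m≤n⇒m≤1+n (ih pp refl))
  ... | no  p∤n = subst₂ _≤_ (sym (ω[p*n]≡1+ω[n] pp 1≤n p∤n)) (sym (Ω[p*n]≡1+Ω[n] pp 1≤n)) (s≤s (ih pp refl))

ω≥1 : ∀ n → 2 ≤ n → 1 ≤ ω n
ω≥1 n 2≤n = prime-induction (λ n → 2 ≤ n → 1 ≤ ω n) (λ { (s≤s ()) }) step n (ℕ.≤-trans (s≤s z≤n) 2≤n) 2≤n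
  where
  step : ∀ {p n} → Prime p → 1 ≤ n → (∀ {q m} → Prime q → q * m ≡ p * n → 2 ≤ m → 1 ≤ ω m) → 2 ≤ p * n → 1 ≤ ω (p * n)
  step {p} {n} pp 1≤n ih _ with p ∣? n
  ... | yes p∣n = subst (1 ≤_) (sym (ω[p*n]≡ω[n] pp 1≤n p∣n)) (ih pp refl (ℕ.≤-trans (prime⇒≥2 pp) (∣⇒≤ {{ℕ.>-nonZero 1≤n}} p∣n)))
  ... | no  p∤n = subst (1 ≤_) (sym (ω[p*n]≡1+ω[n] pp 1≤n p∤n)) (s≤s z≤n)

Ω≡ω-prime : ∀ {p} → Prime p → Ω p ≡ ω p
Ω≡ω-prime {p} pp = subst (λ n → Ω n ≡ ω n) (ℕ.*-identityʳ p)
  (trans (Ω[p*n]≡1+Ω[n] pp ℕ.≤-refl) (sym (ω[p*n]≡1+ω[n] pp ℕ.≤-refl (>⇒∤ (prime⇒≥2 pp)))))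

squarefree-* : ∀ {p n} → Prime p → Squarefree (p * n) → Squarefree n × ¬ p ∣ n
squarefree-* {p} pp sf = (λ q pq q²∣n → sf q pq (∣n⇒∣m*n p q²∣n)) , (λ p∣n → sf p pp (*-monoʳ-∣ p p∣n))

squarefree⇒Ω≡ω : ∀ n → 1 ≤ n → Squarefree n → Ω n ≡ ω n
squarefree⇒Ω≡ω = prime-induction (λ n → Squarefree n → Ω n ≡ ω n) (λ _ → refl) step
  where
  step : ∀ {p n} → Prime p → 1 ≤ n → (∀ {q m} → Prime q → q * m ≡ p * n → Squarefree m → Ω m ≡ ω m) →
         Squarefree (p * n) → Ω (p * n) ≡ ω (p * n)
  step {p} {n} pp 1≤n ih sf = begin
    Ω (p * n)   ≡⟨ Ω[p*n]≡1+Ω[n] pp 1≤n ⟩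
    suc (Ω n)   ≡⟨ cong suc (ih pp refl (proj₁ (squarefree-* pp sf))) ⟩
    suc (ω n)   ≡⟨ ω[p*n]≡1+ω[n] pp 1≤n (proj₂ (squarefree-* pp sf)) ⟨
    ω (p * n)   ∎
    where open ≡-Reasoning

λ[p*n]≡-λ[n] : ∀ {p n} → Prime p → 1 ≤ n → liouville (p * n) ≡ - liouville n
λ[p*n]≡-λ[n] pp 1≤n = trans (cong (λ k → (- 1ℤ) ℤ.^ k) (Ω[p*n]≡1+Ω[n] pp 1≤n)) (ℤ.-1*i≡-i _)

λ≡±1 : ∀ n → liouville n ≡ 1ℤ ⊎ liouville n ≡ - 1ℤ
λ≡±1 n = go (Ω n)
  where
  go : ∀ k → (- 1ℤ) ℤ.^ k ≡ 1ℤ ⊎ (- 1ℤ) ℤ.^ k ≡ - 1ℤ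
  go zero    = inj₁ refl
  go (suc k) with go k
  ... | inj₁ eq = inj₂ (cong (- 1ℤ ℤ.*_) eq)
  ... | inj₂ eq = inj₁ (cong (- 1ℤ ℤ.*_) eq)

λ*λ≡1 : ∀ n → liouville n ℤ.* liouville n ≡ 1ℤ
λ*λ≡1 n with λ≡±1 n
... | inj₁ eq = cong₂ ℤ._*_ eq eq
... | inj₂ eq = cong₂ ℤ._*_ eq eq

-- The Möbius function, using that n is squarefree iff Ω n ≡ ω n.
μ : ℕ → ℤ
μ n = liouville n ℤ.* ⟦ Ω n ≟ ω n ⟧

μ[p*n] : ∀ {p n} → Prime p → 1 ≤ n → μ (p * n) ≡ - (⟦ ¬? (p ∣? n) ⟧ ℤ.* μ n)
μ[p*n] {p} {n} pp 1≤n with p ∣? n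
... | yes p∣n = begin
  liouville (p * n) ℤ.* ⟦ Ω (p * n) ≟ ω (p * n) ⟧ ≡⟨ cong (liouville (p * n) ℤ.*_) (⟦⟧-no (Ω (p * n) ≟ ω (p * n)) Ω≢ω) ⟩
  liouville (p * n) ℤ.* 0ℤ                       ≡⟨ ℤ.*-zeroʳ (liouville (p * n)) ⟩
  - (0ℤ ℤ.* μ n)                                 ∎
  where
  open ≡-Reasoning
  Ω≢ω : Ω (p * n) ≢ ω (p * n)
  Ω≢ω eq = ℕ.<⇒≢ (s≤s (ω≤Ω n 1≤n)) (sym (trans (sym (Ω[p*n]≡1+Ω[n] pp 1≤n)) (trans eq (ω[p*n]≡ω[n] pp 1≤n p∣n))))
... | no  p∤n = begin
  liouville (p * n) ℤ.* ⟦ Ω (p * n) ≟ ω (p * n) ⟧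
    ≡⟨ cong₂ ℤ._*_ (λ[p*n]≡-λ[n] pp 1≤n) (⟦⟧-cong (Ω (p * n) ≟ ω (p * n)) (Ω n ≟ ω n) Ω≡ω⇒ Ω≡ω⇐) ⟩
  - liouville n ℤ.* ⟦ Ω n ≟ ω n ⟧                ≡⟨ ℤ.neg-distribˡ-* (liouville n) _ ⟨
  - μ n                                          ≡⟨ cong -_ (ℤ.*-identityˡ (μ n)) ⟨
  - (1ℤ ℤ.* μ n)                                 ∎
  where
  open ≡-Reasoning
  Ω≡ω⇒ : Ω (p * n) ≡ ω (p * n) → Ω n ≡ ω n
  Ω≡ω⇒ eq = ℕ.suc-injective (trans (sym (Ω[p*n]≡1+Ω[n] pp 1≤n)) (trans eq (ω[p*n]≡1+ω[n] pp 1≤n p∤n)))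
  Ω≡ω⇐ : Ω n ≡ ω n → Ω (p * n) ≡ ω (p * n)
  Ω≡ω⇐ eq = trans (Ω[p*n]≡1+Ω[n] pp 1≤n) (trans (cong suc eq) (sym (ω[p*n]≡1+ω[n] pp 1≤n p∤n)))

divisorSum-μ : ∀ n → 1 ≤ n → divisorSum n μ ≡ ε n
divisorSum-μ 1 _ = refl
divisorSum-μ n@(suc (suc _)) 1≤n with ∃prime-factor {n} (s≤s (s≤s z≤n))
... | p , m , pp , pm≡n = begin
  ∑[ x ≤ n ] (⟦ x ∣? n ⟧ ℤ.* μ x)
    ≡⟨ ∑-cong n (λ x _ → split x) ⟩
  ∑[ x ≤ n ] (⟦ p ∣? x ⟧ ℤ.* (⟦ x ∣? n ⟧ ℤ.* μ x) ℤ.+ ⟦ ¬? (p ∣? x) ⟧ ℤ.* (⟦ x ∣? n ⟧ ℤ.* μ x))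
    ≡⟨ ∑-distrib-+ n _ _ ⟩
  ∑[ x ≤ n ] (⟦ p ∣? x ⟧ ℤ.* (⟦ x ∣? n ⟧ ℤ.* μ x)) ℤ.+ ∑[ x ≤ n ] (⟦ ¬? (p ∣? x) ⟧ ℤ.* (⟦ x ∣? n ⟧ ℤ.* μ x))
    ≡⟨ cong₂ ℤ._+_ (trans (∑-multiples n _ (prime⇒≥1 pp) λ x n<x → ⟦⟧*-no (x ∣? n) (μ x) (>⇒∤ n<x))
                          (∑-cong n λ y (1≤y , _) → multiple y 1≤y))
                   (∑-cong n λ x _ → ⟦⟧*-cong (¬? (p ∣? x)) (λ p∤x → cong (ℤ._* μ x) (⟦⟧-cong (x ∣? n) (x ∣? m)
                      (coprime-divisor (Coprime-sym (prime∤⇒coprime pp p∤x)) ∘ subst (x ∣_) (sym pm≡n))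
                      (subst (x ∣_) pm≡n ∘ ∣n⇒∣m*n p)))) ⟩
  ∑[ y ≤ n ] (- V y) ℤ.+ ∑[ y ≤ n ] V y
    ≡⟨ cong (ℤ._+ ∑ n V) (∑-neg n V) ⟩
  - ∑ n V ℤ.+ ∑ n V
    ≡⟨ ℤ.+-inverseˡ (∑ n V) ⟩
  0ℤ ∎
  where
  open ≡-Reasoning
  instance
    p≢0 : ℕ.NonZero p
    p≢0 = prime⇒nonZero pp
  V : ℕ → ℤ
  V y = ⟦ ¬? (p ∣? y) ⟧ ℤ.* (⟦ y ∣? m ⟧ ℤ.* μ y)
  split : ∀ x → ⟦ x ∣? n ⟧ ℤ.* μ x ≡ ⟦ p ∣? x ⟧ ℤ.* (⟦ x ∣? n ⟧ ℤ.* μ x) ℤ.+ ⟦ ¬? (p ∣? x) ⟧ ℤ.* (⟦ x ∣? n ⟧ ℤ.* μ x)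
  split x = trans (sym (trans (cong (ℤ._* (⟦ x ∣? n ⟧ ℤ.* μ x)) (⟦⟧+⟦¬⟧≡1 (p ∣? x))) (ℤ.*-identityˡ _)))
                  (ℤ.*-distribʳ-+ (⟦ x ∣? n ⟧ ℤ.* μ x) ⟦ p ∣? x ⟧ ⟦ ¬? (p ∣? x) ⟧)
  multiple : ∀ y → 1 ≤ y → ⟦ y * p ∣? n ⟧ ℤ.* μ (y * p) ≡ - V y
  multiple y 1≤y = begin
    ⟦ y * p ∣? n ⟧ ℤ.* μ (y * p)
      ≡⟨ cong₂ ℤ._*_ (⟦⟧-cong (y * p ∣? n) (y ∣? m)
                        (*-cancelˡ-∣ p ∘ subst₂ _∣_ (ℕ.*-comm y p) (sym pm≡n))
                        (subst₂ _∣_ (ℕ.*-comm p y) pm≡n ∘ *-monoʳ-∣ p))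
                     (trans (cong μ (ℕ.*-comm y p)) (μ[p*n] pp 1≤y)) ⟩
    ⟦ y ∣? m ⟧ ℤ.* - (⟦ ¬? (p ∣? y) ⟧ ℤ.* μ y)
      ≡⟨ rearrange ⟦ y ∣? m ⟧ ⟦ ¬? (p ∣? y) ⟧ (μ y) ⟩
    - V y ∎
    where
    rearrange : ∀ a b c → a ℤ.* - (b ℤ.* c) ≡ - (b ℤ.* (a ℤ.* c))
    rearrange = solve-∀

g≡𝟏+ℙ⋆𝟏 : ∀ {d} → 1 ≤ d → g d ≡ 𝟏 d ℤ.+ (ℙ ⋆ 𝟏) d
g≡𝟏+ℙ⋆𝟏 {d} 1≤d = trans (ℤ.pos-+ (ω d) 1) (trans (ℤ.+-comm (+ ω d) 1ℤ) (cong (ℤ._+_ 1ℤ) (sym (ℙ⋆𝟏≡ω 1≤d))))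

g⋆≡𝟏⋆ : ∀ G n → 1 ≤ n → (g ⋆ G) n ≡ (𝟏 ⋆ (λ x → G x ℤ.+ (ℙ ⋆ G) x)) n
g⋆≡𝟏⋆ G n 1≤n = begin
  (g ⋆ G) n                                     ≡⟨ ⋆-cong n 1≤n (λ d (1≤d , _) → g≡𝟏+ℙ⋆𝟏 1≤d) (λ _ _ → refl) ⟩
  ((λ x → 𝟏 x ℤ.+ (ℙ ⋆ 𝟏) x) ⋆ G) n            ≡⟨ ⋆-distribʳ-+ 𝟏 (ℙ ⋆ 𝟏) G n ⟩
  (𝟏 ⋆ G) n ℤ.+ ((ℙ ⋆ 𝟏) ⋆ G) n
    ≡⟨ cong (ℤ._+_ ((𝟏 ⋆ G) n)) (⋆-cong n 1≤n (λ d _ → ⋆-comm ℙ 𝟏 d) (λ _ _ → refl)) ⟩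
  (𝟏 ⋆ G) n ℤ.+ ((𝟏 ⋆ ℙ) ⋆ G) n                 ≡⟨ cong (ℤ._+_ ((𝟏 ⋆ G) n)) (⋆-assoc 𝟏 ℙ G n 1≤n) ⟩
  (𝟏 ⋆ G) n ℤ.+ (𝟏 ⋆ (ℙ ⋆ G)) n                 ≡⟨ ⋆-distribˡ-+ 𝟏 G (ℙ ⋆ G) n ⟨
  (𝟏 ⋆ (λ x → G x ℤ.+ (ℙ ⋆ G) x)) n            ∎
  where open ≡-Reasoning

inverse+ℙ⋆inverse≡μ : ∀ G → IsDirichletInverse g G → ∀ n → 1 ≤ n → G n ℤ.+ (ℙ ⋆ G) n ≡ μ n
inverse+ℙ⋆inverse≡μ G inv = divisorSum-injective _ μ λ n 1≤n → begin
  divisorSum n (λ x → G x ℤ.+ (ℙ ⋆ G) x)   ≡⟨ 𝟏⋆≡divisorSum _ 1≤n ⟨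
  (𝟏 ⋆ (λ x → G x ℤ.+ (ℙ ⋆ G) x)) n        ≡⟨ g⋆≡𝟏⋆ G n 1≤n ⟨
  (g ⋆ G) n                                ≡⟨ dirichlet≡pairSum g G n ⟨
  dirichlet g G n                          ≡⟨ inv n 1≤n ⟩
  ε n                                      ≡⟨ divisorSum-μ n 1≤n ⟨
  divisorSum n μ                           ∎
  where open ≡-Reasoning

twist : (ℕ → ℤ) → ℕ → ℤ
twist G n = liouville n ℤ.* G n

λ*[ℙ⋆G]≡-ℙ⋆twist : ∀ G n → 1 ≤ n → liouville n ℤ.* (ℙ ⋆ G) n ≡ - (ℙ ⋆ twist G) n
λ*[ℙ⋆G]≡-ℙ⋆twist G n 1≤n = begin
  liouville n ℤ.* (ℙ ⋆ G) n
    ≡⟨ *-distribˡ-pairSum (liouville n) n _ ⟩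
  pairSum n (λ p e → liouville n ℤ.* (ℙ p ℤ.* G e))
    ≡⟨ pairSum-cong n (λ p e pe≡n → subst (λ x → liouville x ℤ.* (ℙ p ℤ.* G e) ≡ - 1ℤ ℤ.* (ℙ p ℤ.* twist G e)) pe≡n
                                      (λ[p*e]-term p e (proj₁ (*≡⇒∈[1,]ʳ {p} 1≤n pe≡n)))) ⟩
  pairSum n (λ p e → - 1ℤ ℤ.* (ℙ p ℤ.* twist G e))
    ≡⟨ *-distribˡ-pairSum (- 1ℤ) n _ ⟨
  - 1ℤ ℤ.* (ℙ ⋆ twist G) n
    ≡⟨ ℤ.-1*i≡-i _ ⟩
  - (ℙ ⋆ twist G) n ∎
  where
  open ≡-Reasoning
  λ[p*e]-term : ∀ p e → 1 ≤ e → liouville (p * e) ℤ.* (ℙ p ℤ.* G e) ≡ - 1ℤ ℤ.* (ℙ p ℤ.* twist G e)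
  λ[p*e]-term p e 1≤e = begin
    liouville (p * e) ℤ.* (ℙ p ℤ.* G e)      ≡⟨ swap (liouville (p * e)) (ℙ p) (G e) ⟩
    ℙ p ℤ.* (liouville (p * e) ℤ.* G e)      ≡⟨ ⟦⟧*-cong (prime? p) (λ pp → cong (ℤ._* G e) (λ[p*n]≡-λ[n] pp 1≤e)) ⟩
    ℙ p ℤ.* (- liouville e ℤ.* G e)          ≡⟨ pull-sign (ℙ p) (liouville e) (G e) ⟩
    - 1ℤ ℤ.* (ℙ p ℤ.* twist G e)             ∎
    where
    swap : ∀ a b c → a ℤ.* (b ℤ.* c) ≡ b ℤ.* (a ℤ.* c)
    swap = solve-∀
    pull-sign : ∀ a b c → a ℤ.* (- b ℤ.* c) ≡ - 1ℤ ℤ.* (a ℤ.* (b ℤ.* c))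
    pull-sign = solve-∀

twist-recurrence : ∀ G → IsDirichletInverse g G → ∀ n → 1 ≤ n → twist G n ≡ ⟦ Ω n ≟ ω n ⟧ ℤ.+ (ℙ ⋆ twist G) n
twist-recurrence G inv n 1≤n = begin
  liouville n ℤ.* G n
    ≡⟨ cong (liouville n ℤ.*_) (G≡μ-ℙ⋆G) ⟩
  liouville n ℤ.* (μ n ℤ.+ - (ℙ ⋆ G) n)
    ≡⟨ ℤ.*-distribˡ-+ (liouville n) (μ n) _ ⟩
  liouville n ℤ.* μ n ℤ.+ liouville n ℤ.* - (ℙ ⋆ G) n
    ≡⟨ cong₂ ℤ._+_ λμ≡ (trans (sym (ℤ.neg-distribʳ-* (liouville n) _)) (cong -_ (λ*[ℙ⋆G]≡-ℙ⋆twist G n 1≤n))) ⟩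
  ⟦ Ω n ≟ ω n ⟧ ℤ.+ - - (ℙ ⋆ twist G) n
    ≡⟨ cong (ℤ._+_ ⟦ Ω n ≟ ω n ⟧) (ℤ.neg-involutive _) ⟩
  ⟦ Ω n ≟ ω n ⟧ ℤ.+ (ℙ ⋆ twist G) n ∎
  where
  open ≡-Reasoning
  G≡μ-ℙ⋆G : G n ≡ μ n ℤ.+ - (ℙ ⋆ G) n
  G≡μ-ℙ⋆G = trans (move (G n) ((ℙ ⋆ G) n)) (cong (ℤ._+ - (ℙ ⋆ G) n) (inverse+ℙ⋆inverse≡μ G inv n 1≤n))
    where
    move : ∀ x y → x ≡ (x ℤ.+ y) ℤ.+ - y
    move = solve-∀
  λμ≡ : liouville n ℤ.* μ n ≡ ⟦ Ω n ≟ ω n ⟧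
  λμ≡ = trans (sym (ℤ.*-assoc (liouville n) (liouville n) _)) (trans (cong (ℤ._* ⟦ Ω n ≟ ω n ⟧) (λ*λ≡1 n)) (ℤ.*-identityˡ _))

ℙ⋆const : ∀ c {n} → 1 ≤ n → (ℙ ⋆ (λ _ → c)) n ≡ + ω n ℤ.* c
ℙ⋆const c {n} 1≤n = begin
  pairSum n (λ p e → ℙ p ℤ.* c)          ≡⟨ pairSum-cong n (λ p e _ → cong (ℤ._* c) (ℤ.*-identityʳ (ℙ p))) ⟨
  pairSum n (λ p e → ℙ p ℤ.* 1ℤ ℤ.* c)   ≡⟨ *-distribʳ-pairSum c n _ ⟨
  (ℙ ⋆ 𝟏) n ℤ.* c                        ≡⟨ cong (ℤ._* c) (ℙ⋆𝟏≡ω 1≤n) ⟩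
  + ω n ℤ.* c                            ∎
  where open ≡-Reasoning

module _ (F : ℕ → ℤ) (c : ℤ) {n} (1≤n : 1 ≤ n) where

  ℙ⋆-lower : (∀ {p e} → Prime p → p * e ≡ n → c ℤ.≤ F e) → + ω n ℤ.* c ℤ.≤ (ℙ ⋆ F) n
  ℙ⋆-lower c≤F = subst (ℤ._≤ (ℙ ⋆ F) n) (ℙ⋆const c 1≤n)
    (pairSum-mono-≤ n λ p e pe≡n → ⟦⟧*-mono (prime? p) λ pp → c≤F pp pe≡n)

  ℙ⋆-upper : (∀ {p e} → Prime p → p * e ≡ n → F e ℤ.≤ c) → (ℙ ⋆ F) n ℤ.≤ + ω n ℤ.* c
  ℙ⋆-upper F≤c = subst ((ℙ ⋆ F) n ℤ.≤_) (ℙ⋆const c 1≤n)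
    (pairSum-mono-≤ n λ p e pe≡n → ⟦⟧*-mono (prime? p) λ pp → F≤c pp pe≡n)

  ℙ⋆-exact : (∀ {p e} → Prime p → p * e ≡ n → F e ≡ c) → (ℙ ⋆ F) n ≡ + ω n ℤ.* c
  ℙ⋆-exact F≡c = trans (pairSum-cong n λ p e pe≡n → ⟦⟧*-cong (prime? p) λ pp → F≡c pp pe≡n)
                       (ℙ⋆const c 1≤n)

-- Arrangement numbers

[k+1]*[n+1]C[k+1]≡[n+1]*nCk : ∀ n k → suc k * (suc n C suc k) ≡ suc n * (n C k)
[k+1]*[n+1]C[k+1]≡[n+1]*nCk zero    zero    = refl
[k+1]*[n+1]C[k+1]≡[n+1]*nCk zero    (suc k) = ℕ.*-zeroʳ (suc (suc k))
[k+1]*[n+1]C[k+1]≡[n+1]*nCk (suc n) zero    = trans (ℕ.+-identityʳ _) (trans (nC1≡n (suc (suc n))) (sym (ℕ.*-identityʳ _)))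
[k+1]*[n+1]C[k+1]≡[n+1]*nCk (suc n) (suc k) = begin
  suc (suc k) * (suc (suc n) C suc (suc k))
    ≡⟨ cong (suc (suc k) *_) (nCk+nC[k+1]≡[n+1]C[k+1] (suc n) (suc k)) ⟨
  suc (suc k) * (a + b)
    ≡⟨ expand k a b ⟩
  suc k * a + a + suc (suc k) * b
    ≡⟨ cong₂ (λ x y → x + a + y) ([k+1]*[n+1]C[k+1]≡[n+1]*nCk n k) ([k+1]*[n+1]C[k+1]≡[n+1]*nCk n (suc k)) ⟩
  suc n * (n C k) + a + suc n * (n C suc k)
    ≡⟨ regroup n (n C k) a (n C suc k) ⟩
  suc n * (n C k + n C suc k) + a
    ≡⟨ cong (λ x → suc n * x + a) (nCk+nC[k+1]≡[n+1]C[k+1] n k) ⟩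
  suc n * a + a
    ≡⟨ ℕ.+-comm (suc n * a) a ⟩
  suc (suc n) * a ∎
  where
  open ≡-Reasoning
  a b : ℕ
  a = suc n C suc k
  b = suc n C suc (suc k)
  expand : ∀ k a b → suc (suc k) * (a + b) ≡ suc k * a + a + suc (suc k) * b
  expand = ℕ-solve-∀
  regroup : ∀ n c a d → suc n * c + a + suc n * d ≡ suc n * (c + d) + a
  regroup = ℕ-solve-∀

arrSum-suc : ∀ k → arrSum (suc k) ≡ 1 + suc k * arrSum k
arrSum-suc k = begin
  arrSum (suc k)
    ≡⟨⟩
  1 + sum (map term (applyUpTo suc (suc k)))
    ≡⟨ cong (λ xs → 1 + sum xs) (trans (List.map-applyUpTo suc term (suc k))
                                       (sym (List.map-applyUpTo (λ x → x) (term ∘ suc) (suc k)))) ⟩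
  1 + sum (map (term ∘ suc) (upTo (suc k)))
    ≡⟨ cong (λ xs → 1 + sum xs) (List.map-cong absorb (upTo (suc k))) ⟩
  1 + sum (map (λ m → suc k * ((k C m) * m !)) (upTo (suc k)))
    ≡⟨ cong (λ s → 1 + s) (sum-map-*ˡ (suc k) (λ m → (k C m) * m !) (upTo (suc k))) ⟩
  1 + suc k * arrSum k ∎
  where
  open ≡-Reasoning
  term : ℕ → ℕ
  term m = (suc k C m) * m !
  absorb : ∀ m → term (suc m) ≡ suc k * ((k C m) * m !)
  absorb m = begin
    (suc k C suc m) * (suc m * m !)   ≡⟨ *-comm-middle (suc k C suc m) (suc m) (m !) ⟩
    suc m * (suc k C suc m) * m !     ≡⟨ cong (_* m !) ([k+1]*[n+1]C[k+1]≡[n+1]*nCk k m) ⟩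
    suc k * (k C m) * m !             ≡⟨ ℕ.*-assoc (suc k) (k C m) (m !) ⟩
    suc k * ((k C m) * m !)           ∎
    where
    *-comm-middle : ∀ c s f → c * (s * f) ≡ s * c * f
    *-comm-middle = ℕ-solve-∀
  sum-map-*ˡ : ∀ c (f : ℕ → ℕ) xs → sum (map (λ x → c * f x) xs) ≡ c * sum (map f xs)
  sum-map-*ˡ c f []       = sym (ℕ.*-zeroʳ c)
  sum-map-*ˡ c f (x ∷ xs) =
    trans (cong (λ s → c * f x + s) (sum-map-*ˡ c f xs)) (sym (ℕ.*-distribˡ-+ c (f x) (sum (map f xs))))

-- The inverse of g

≡λ*twist : ∀ G n → G n ≡ liouville n ℤ.* twist G n
≡λ*twist G n = sym (trans (sym (ℤ.*-assoc (liouville n) (liouville n) (G n)))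
                          (trans (cong (ℤ._* G n) (λ*λ≡1 n)) (ℤ.*-identityˡ (G n))))

sgn[±1*i] : ∀ {l} i → l ≡ 1ℤ ⊎ l ≡ - 1ℤ → 1ℤ ℤ.≤ i → sgn (l ℤ.* i) ≡ l
sgn[±1*i] (+ suc j) (inj₁ refl) _         = cong sgn (ℤ.*-identityˡ (+ suc j))
sgn[±1*i] (+ suc j) (inj₂ refl) _         = cong sgn (ℤ.-1*i≡-i (+ suc j))
sgn[±1*i] (+ zero)  _           (+≤+ ())

∣±1*i∣≡∣i∣ : ∀ {l} i → l ≡ 1ℤ ⊎ l ≡ - 1ℤ → ∣ l ℤ.* i ∣ ≡ ∣ i ∣
∣±1*i∣≡∣i∣ i (inj₁ refl) = cong ∣_∣ (ℤ.*-identityˡ i)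
∣±1*i∣≡∣i∣ i (inj₂ refl) = trans (cong ∣_∣ (ℤ.-1*i≡-i i)) (ℤ.∣-i∣≡∣i∣ i)

module _ (G : ℕ → ℤ) (inv : IsDirichletInverse g G) where

  private
    a : ℕ → ℤ
    a = twist G

  twist[1]≡1 : a 1 ≡ 1ℤ
  twist[1]≡1 = twist-recurrence G inv 1 ℕ.≤-refl

  twist-lower : ∀ n → 1 ≤ n → 1ℤ ℤ.≤ a n × (2 ≤ n → + 2 ℤ.≤ a n)
  twist-lower = prime-induction (λ n → 1ℤ ℤ.≤ a n × (2 ≤ n → + 2 ℤ.≤ a n))
    (ℤ.≤-reflexive (sym twist[1]≡1) , λ { (s≤s ()) }) step
    where
    step : ∀ {p m} → Prime p → 1 ≤ m → (∀ {q k} → Prime q → q * k ≡ p * m → 1ℤ ℤ.≤ a k × (2 ≤ k → + 2 ℤ.≤ a k)) →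
           1ℤ ℤ.≤ a (p * m) × (2 ≤ p * m → + 2 ℤ.≤ a (p * m))
    step {p} {m} pp 1≤m ih = ℤ.≤-trans (+≤+ (s≤s z≤n)) 2≤a[x] , λ _ → 2≤a[x]
      where
      x : ℕ
      x = p * m
      1≤x : 1 ≤ x
      1≤x = ℕ.*-mono-≤ (prime⇒≥1 pp) 1≤m
      1≤ω[x] : 1 ≤ ω x
      1≤ω[x] = ω≥1 x (ℕ.*-mono-≤ (prime⇒≥2 pp) 1≤m)
      2≤a[x] : + 2 ℤ.≤ a x
      2≤a[x] with prime? x
      ... | yes px = begin
        + 2                                 ≤⟨ ℤ.+-monoʳ-≤ 1ℤ (+≤+ 1≤ω[x]) ⟩
        1ℤ ℤ.+ + ω x                        ≡⟨ cong (ℤ._+_ 1ℤ) (ℤ.*-identityʳ (+ ω x)) ⟨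
        1ℤ ℤ.+ + ω x ℤ.* 1ℤ                 ≤⟨ ℤ.+-mono-≤ (ℤ.≤-reflexive (sym (⟦⟧-yes (Ω x ≟ ω x) (Ω≡ω-prime px))))
                                                         (ℙ⋆-lower a 1ℤ 1≤x λ pq qk≡x → proj₁ (ih pq qk≡x)) ⟩
        ⟦ Ω x ≟ ω x ⟧ ℤ.+ (ℙ ⋆ a) x         ≡⟨ twist-recurrence G inv x 1≤x ⟨
        a x                                 ∎
        where open ℤ.≤-Reasoning
      ... | no ¬px = begin
        + 2                                 ≤⟨ +≤+ (ℕ.*-monoˡ-≤ 2 1≤ω[x]) ⟩
        + (ω x ℕ.* 2)                       ≡⟨ ℤ.pos-* (ω x) 2 ⟩
        + ω x ℤ.* + 2                       ≤⟨ ℙ⋆-lower a (+ 2) 1≤x (λ pq qk≡x → proj₂ (ih pq qk≡x) (cofactor≥2 pq qk≡x)) ⟩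
        (ℙ ⋆ a) x                           ≤⟨ ℤ.i≤j+i _ ⟦ Ω x ≟ ω x ⟧ {{ℤ.nonNegative (0≤⟦⟧ (Ω x ≟ ω x))}} ⟩
        ⟦ Ω x ≟ ω x ⟧ ℤ.+ (ℙ ⋆ a) x         ≡⟨ twist-recurrence G inv x 1≤x ⟨
        a x                                 ∎
        where
        open ℤ.≤-Reasoning
        cofactor≥2 : ∀ {q k} → Prime q → q * k ≡ x → 2 ≤ k
        cofactor≥2 {q} {1} pq qk≡x = contradiction (subst Prime (trans (sym (ℕ.*-identityʳ q)) qk≡x) pq) ¬px
        cofactor≥2 {q} {suc (suc _)} _ _ = s≤s (s≤s z≤n)
        cofactor≥2 {q} {0} _ qk≡x = contradiction (trans (sym qk≡x) (ℕ.*-zeroʳ q)) (ℕ.>⇒≢ 1≤x)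

  twist-upper : ∀ n → 1 ≤ n → a n ℤ.≤ + arrSum (Ω n)
  twist-upper = prime-induction (λ n → a n ℤ.≤ + arrSum (Ω n)) (ℤ.≤-reflexive twist[1]≡1) step
    where
    step : ∀ {p m} → Prime p → 1 ≤ m → (∀ {q k} → Prime q → q * k ≡ p * m → a k ℤ.≤ + arrSum (Ω k)) →
           a (p * m) ℤ.≤ + arrSum (Ω (p * m))
    step {p} {m} pp 1≤m ih = begin
      a x                                               ≡⟨ twist-recurrence G inv x 1≤x ⟩
      ⟦ Ω x ≟ ω x ⟧ ℤ.+ (ℙ ⋆ a) x
        ≤⟨ ℤ.+-mono-≤ (⟦⟧≤1 (Ω x ≟ ω x)) (ℙ⋆-upper a (+ arrSum (Ω m)) 1≤x cofactor-bound) ⟩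
      1ℤ ℤ.+ + ω x ℤ.* + arrSum (Ω m)
        ≤⟨ ℤ.+-monoʳ-≤ 1ℤ (ℤ.*-monoʳ-≤-nonNeg (+ arrSum (Ω m)) (+≤+ ω[x]≤1+Ω[m])) ⟩
      1ℤ ℤ.+ + suc (Ω m) ℤ.* + arrSum (Ω m)             ≡⟨ cong (ℤ._+_ 1ℤ) (ℤ.pos-* (suc (Ω m)) (arrSum (Ω m))) ⟨
      + (1 ℕ.+ suc (Ω m) ℕ.* arrSum (Ω m))              ≡⟨ cong +_ (arrSum-suc (Ω m)) ⟨
      + arrSum (suc (Ω m))                              ≡⟨ cong (λ k → + arrSum k) (Ω[p*n]≡1+Ω[n] pp 1≤m) ⟨
      + arrSum (Ω x)                                    ∎
      where
      open ℤ.≤-Reasoning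
      x : ℕ
      x = p * m
      1≤x : 1 ≤ x
      1≤x = ℕ.*-mono-≤ (prime⇒≥1 pp) 1≤m
      ω[x]≤1+Ω[m] : ω x ≤ suc (Ω m)
      ω[x]≤1+Ω[m] = subst (ω x ≤_) (Ω[p*n]≡1+Ω[n] pp 1≤m) (ω≤Ω x 1≤x)
      cofactor-bound : ∀ {q k} → Prime q → q * k ≡ x → a k ℤ.≤ + arrSum (Ω m)
      cofactor-bound {q} {k} pq qk≡x = subst (λ j → a k ℤ.≤ + arrSum j) Ω[k]≡Ω[m] (ih pq qk≡x)
        where
        1≤k : 1 ≤ k
        1≤k = proj₁ (*≡⇒∈[1,]ʳ {q} 1≤x qk≡x)
        Ω[k]≡Ω[m] : Ω k ≡ Ω m
        Ω[k]≡Ω[m] = ℕ.suc-injective (trans (sym (Ω[p*n]≡1+Ω[n] pq 1≤k)) (trans (cong Ω qk≡x) (Ω[p*n]≡1+Ω[n] pp 1≤m)))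

  twist-squarefree : ∀ n → 1 ≤ n → Squarefree n → a n ≡ + arrSum (ω n)
  twist-squarefree = prime-induction (λ n → Squarefree n → a n ≡ + arrSum (ω n)) (λ _ → twist[1]≡1) step
    where
    step : ∀ {p m} → Prime p → 1 ≤ m → (∀ {q k} → Prime q → q * k ≡ p * m → Squarefree k → a k ≡ + arrSum (ω k)) →
           Squarefree (p * m) → a (p * m) ≡ + arrSum (ω (p * m))
    step {p} {m} pp 1≤m ih sf = begin
      a x                                               ≡⟨ twist-recurrence G inv x 1≤x ⟩
      ⟦ Ω x ≟ ω x ⟧ ℤ.+ (ℙ ⋆ a) x                       ≡⟨ cong₂ ℤ._+_ (⟦⟧-yes (Ω x ≟ ω x) (squarefree⇒Ω≡ω x 1≤x sf))
                                                                       (ℙ⋆-exact a (+ arrSum (ω m)) 1≤x cofactor-value) ⟩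
      1ℤ ℤ.+ + ω x ℤ.* + arrSum (ω m)                   ≡⟨ cong (λ j → 1ℤ ℤ.+ + j ℤ.* + arrSum (ω m)) ω[x]≡1+ω[m] ⟩
      1ℤ ℤ.+ + suc (ω m) ℤ.* + arrSum (ω m)             ≡⟨ cong (ℤ._+_ 1ℤ) (ℤ.pos-* (suc (ω m)) (arrSum (ω m))) ⟨
      + (1 ℕ.+ suc (ω m) ℕ.* arrSum (ω m))              ≡⟨ cong +_ (arrSum-suc (ω m)) ⟨
      + arrSum (suc (ω m))                              ≡⟨ cong (λ j → + arrSum j) ω[x]≡1+ω[m] ⟨
      + arrSum (ω x)                                    ∎
      where
      open ≡-Reasoning
      x : ℕ
      x = p * m
      1≤x : 1 ≤ x
      1≤x = ℕ.*-mono-≤ (prime⇒≥1 pp) 1≤m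
      ω[x]≡1+ω[m] : ω x ≡ suc (ω m)
      ω[x]≡1+ω[m] = ω[p*n]≡1+ω[n] pp 1≤m (proj₂ (squarefree-* pp sf))
      cofactor-value : ∀ {q k} → Prime q → q * k ≡ x → a k ≡ + arrSum (ω m)
      cofactor-value {q} {k} pq qk≡x = trans (ih pq qk≡x (proj₁ sf-k)) (cong (λ j → + arrSum j) ω[k]≡ω[m])
        where
        1≤k : 1 ≤ k
        1≤k = proj₁ (*≡⇒∈[1,]ʳ {q} 1≤x qk≡x)
        sf-k : Squarefree k × ¬ q ∣ k
        sf-k = squarefree-* pq (subst Squarefree (sym qk≡x) sf)
        ω[k]≡ω[m] : ω k ≡ ω m
        ω[k]≡ω[m] = ℕ.suc-injective (trans (sym (ω[p*n]≡1+ω[n] pq 1≤k (proj₂ sf-k))) (trans (cong ω qk≡x) ω[x]≡1+ω[m]))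

  +∣inverse∣≡twist : ∀ n → 1 ≤ n → + ∣ G n ∣ ≡ a n
  +∣inverse∣≡twist n 1≤n = begin
    + ∣ G n ∣                          ≡⟨ cong (λ i → + ∣ i ∣) (≡λ*twist G n) ⟩
    + ∣ liouville n ℤ.* a n ∣          ≡⟨ cong +_ (∣±1*i∣≡∣i∣ (a n) (λ≡±1 n)) ⟩
    + ∣ a n ∣                          ≡⟨ ℤ.0≤i⇒+∣i∣≡i (ℤ.≤-trans (+≤+ z≤n) (proj₁ (twist-lower n 1≤n))) ⟩
    a n                                ∎
    where open ≡-Reasoning

  sgn-inverse : ∀ n → 1 ≤ n → sgn (G n) ≡ liouville n
  sgn-inverse n 1≤n = trans (cong sgn (≡λ*twist G n)) (sgn[±1*i] (a n) (λ≡±1 n) (proj₁ (twist-lower n 1≤n)))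

proposition1p6 : (ginv : ℕ → ℤ) → IsDirichletInverse g ginv →
    ((n : ℕ) → 1 ≤ n → sgn (ginv n) ≡ liouville n)
    × ((n : ℕ) → 1 ≤ n → Squarefree n → ∣ ginv n ∣ ≡ arrSum (ω n))
    × ((n k : ℕ) → 2 ≤ n → 1 ≤ k → Ω n ≡ k →
        (2 ≤ ∣ ginv n ∣) × (∣ ginv n ∣ ≤ arrSum k))
proposition1p6 G inv = sgn-inverse G inv , squarefree , bounds
  where
  squarefree : ∀ n → 1 ≤ n → Squarefree n → ∣ G n ∣ ≡ arrSum (ω n)
  squarefree n 1≤n sf = ℤ.+-injective (trans (+∣inverse∣≡twist G inv n 1≤n) (twist-squarefree G inv n 1≤n sf))
  bounds : ∀ n k → 2 ≤ n → 1 ≤ k → Ω n ≡ k → (2 ≤ ∣ G n ∣) × (∣ G n ∣ ≤ arrSum k)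
  bounds n _ 2≤n _ refl =
      ℤ.drop‿+≤+ (subst (+ 2 ℤ.≤_) (sym (+∣inverse∣≡twist G inv n 1≤n)) (proj₂ (twist-lower G inv n 1≤n) 2≤n))
    , ℤ.drop‿+≤+ (subst (ℤ._≤ + arrSum (Ω n)) (sym (+∣inverse∣≡twist G inv n 1≤n)) (twist-upper G inv n 1≤n))
    where
    1≤n : 1 ≤ n
    1≤n = ℕ.≤-trans (s≤s z≤n) 2≤n
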